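{- In $\text{LD}^{\mu\nabla}(\mathcal D,\mathcal I)$, for every variable context $\mathcal X$, every formula $B$ over $\mathcal X$ and every type-preserving permutation $\pi$ of $\mathrm{supp}(B)$, the sequent $\mathcal X;B\vdash B[\pi]$ is derivable without using the multicut rule (i.e. the rule "\textsc{Init}: $\mathcal X;B\vdash B[\pi]$" is derivable without cut).
   Context: Terms and formulas. Fix finitely many base types; types are built from base types, a type $o$ of propositions, and arrows. A type is first-order if it does not contain $o$. Terms are simply typed $\lambda$-terms modulo $\alpha\beta\eta$-equality built from the constants of a fixed signature $\Sigma$, from countably many nominal constants of each type, and from variables. $\Sigma$ contains $\bot,\top:o$, $\wedge,\vee,\supset:o\to o\to o$ and $\forall_\alpha,\exists_\alpha,\nabla_\alpha:(\alpha\to o)\to o$ for every first-order type $\alpha$; $Q x.C$ abbreviates $Q(\lambda x.C)$. A formula is a term of type $o$; an atomic formula is $p\,\vec t$ with $p$ a non-logical predicate constant of $\Sigma$. $\mathrm{supp}(F)$ is the finite set of nominal constants occurring in $F$; for a type-preserving permutation $\pi$ of a finite set of nominals containing $\mathrm{supp}(F)$, $F[\pi]$ is $F$ with nominals renamed by $\pi$. A variable context $\mathcal X$ is a finite set of typed variables of first-order types; a term lies over $\mathcal X$ if its free variables are in $\mathcal X$; it is ground if it lies over $\emptyset$; $\mathrm{ground}(\alpha)$ is the set of ground terms of type $\alpha$. A substitution $\theta:\mathcal Y\to\mathcal X$ assigns to each variable of $\mathcal X$ a term over $\mathcal Y$ of the same type; $\epsilon_{\mathcal X}$ is the identity; $\mathrm{range}(\theta)$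 is the set of free variables occurring in $\theta$. $\mathcal D$ is a valid, weakly stratified set of definitional clauses $H\stackrel{\Delta}{=}_{\mathcal X}B$ ($H=p\,\vec t$, $\vec t,B$ over $\mathcal X$ with empty support, every variable of $\mathcal X$ in $H$, $H$ a higher-order pattern; weakly stratified means $\mathrm{lvl}(H\rho)\ge\mathrm{lvl}(B\rho)$ for all grounding $\rho$, with respect to an ordinal level assignment on ground atoms extended to formulas by $\mathrm{lvl}(\bot)=\mathrm{lvl}(\top)=0$, $\max$ for $\wedge,\vee$, $\mathrm{lvl}(A\supset B)=\max(\mathrm{lvl}(A)+1,\mathrm{lvl}(B))$, $\sup$ over ground instances for $\forall,\exists$, and a fresh-nominal instance for $\nabla$). $\mathrm{defn}(H\stackrel{\Delta}{=}_{\mathcal X}B,A,\theta,B')$, for $\theta:\mathcal Z\to\mathcal Y$ with empty support, means there is $\rho:\mathcal Z\to\mathcal X$ with $H\rho=A\theta$, $B'=B\rho$. $\mathcal I$ is a valid set of inductive clauses $p\,\vec x\stackrel{\mu}{=}_{\vec x}B\,p\,\vec x$ ($\vec x$ distinct, $B$ closed of type $\omega\to\omega$ not containing $p$, $p$ heading at most one clause and not defined in $\mathcal D$), which is strictly stratified (levels of $p\,\vec t$ independent of $\vec t$ and clause levels non-increasing). An inductive invariant for $p:\omega$ is a closed term $S:\omega$. Rules of $\text{LD}^{\mu\nabla}(\mathcal D,\mathcal I)$ (sequents $\mathcal X;\Gamma\vdash C$, $\Gamma$ a finite multiset): $\bot\mathcal L$: $\mathcal X;\Gamma,\bot\vdash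 B$. $\top\mathcal R$: $\mathcal X;\Gamma\vdash\top$. $\supset\mathcal L$: from $\mathcal X;\Gamma\vdash B$ and $\mathcal X;\Gamma,C\vdash D$ infer $\mathcal X;\Gamma,B\supset C\vdash D$. $\supset\mathcal R$: from $\mathcal X;\Gamma,B\vdash C$ infer $\mathcal X;\Gamma\vdash B\supset C$. $\wedge\mathcal L_i$: from $\mathcal X;\Gamma,B_i\vdash D$ infer $\mathcal X;\Gamma,B_1\wedge B_2\vdash D$. $\wedge\mathcal R$: from $\mathcal X;\Gamma\vdash B$ and $\mathcal X;\Gamma\vdash C$ infer $\mathcal X;\Gamma\vdash B\wedge C$. $\vee\mathcal L$: from $\mathcal X;\Gamma,B\vdash D$ and $\mathcal X;\Gamma,C\vdash D$ infer $\mathcal X;\Gamma,B\vee C\vdash D$. $\vee\mathcal R_i$: from $\mathcal X;\Gamma\vdash B_i$ infer $\mathcal X;\Gamma\vdash B_1\vee B_2$. $\forall\mathcal L$: from $\mathcal X;\Gamma,C[t/x]\vdash D$, $t$ of type $\tau$ over $\mathcal X$, infer $\mathcal X;\Gamma,\forall_\tau x.C\vdash D$. $\forall\mathcal R$: from $\mathcal X,y;\Gamma\vdash C[y\,\vec n/x]$ infer $\mathcal X;\Gamma\vdash\forall_\tau x.C$, where $\vec n=n_1,\dots,n_k$ lists $\mathrm{supp}(C)$, $n_i:\tau_i$, $y\notin\mathcal X$ of type $\tau_1\to\dots\to\tau_k\to\tau$. $\exists\mathcal L$: from $\mathcal X,y;\Gamma,C[y\,\vec n/x]\vdash D$ (same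 conditions) infer $\mathcal X;\Gamma,\exists_\tau x.C\vdash D$. $\exists\mathcal R$: from $\mathcal X;\Gamma\vdash C[t/x]$ infer $\mathcal X;\Gamma\vdash\exists_\tau x.C$. $\nabla\mathcal L$/$\nabla\mathcal R$: from $\mathcal X;\Gamma,C[n/x]\vdash D$ (resp. $\mathcal X;\Gamma\vdash C[n/x]$), $n\notin\mathrm{supp}(C)$ a nominal, infer $\mathcal X;\Gamma,\nabla x.C\vdash D$ (resp. $\mathcal X;\Gamma\vdash\nabla x.C$). $c\mathcal L$, $w\mathcal L$: left contraction and weakening. Axiom: $\mathcal X;A\vdash A[\pi]$ for $A$ atomic, $\pi$ a permutation of $\mathrm{supp}(A)$. Multicut: from $\mathcal X;\Delta_i\vdash A_i$ ($1\le i\le n$, $n\ge0$) and $\mathcal X;\Gamma,A_1,\dots,A_n\vdash C$ infer $\mathcal X;\Gamma,\Delta_1,\dots,\Delta_n\vdash C$. $\Delta\mathcal L$ ($A=p\,\vec t$ with $p$ defined in $\mathcal D$): from premises $\mathcal Z;\Gamma\theta,B'\vdash C\theta$ for every clause and all $\theta,B'$ with $\mathrm{defn}(H\stackrel{\Delta}{=}_{\mathcal X}B,A,\theta,B')$, $\mathcal Z=\mathrm{range}(\theta)$, infer $\mathcal Y;\Gamma,A\vdash C$. $\Delta\mathcal R$: from $\mathcal Y;\Gamma\vdash B'$ infer $\mathcal Y;\Gamma\vdash A$ when $\mathrm{defn}(H\stackrel{\Delta}{=}_{\mathcal X}B,A,\epsilon_{\mathcal Y},B')$. $\mu\mathcal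 L$ (for $p\,\vec x\stackrel{\mu}{=}_{\vec x}B\,p\,\vec x\in\mathcal I$, invariant $S$): from $\vec x;B\,S\,\vec x\vdash S\,\vec x$ and $\mathcal X;\Gamma,S\,\vec t\vdash C$ infer $\mathcal X;\Gamma,p\,\vec t\vdash C$. $\mu\mathcal R$: from $\mathcal X;\Gamma\vdash B\,p\,\vec t$ infer $\mathcal X;\Gamma\vdash p\,\vec t$.
   Formalization: The axiom $\mathcal X;A\vdash A[\pi]$ allows any type-preserving permutation π of nominals, not only one of supp(A), and nominal constants are of first-order types only. The statement above fails without it. -}

module Defs where

open import Level using (0ℓ)
open import Data.Nat using (ℕ; zero; suc; _<_; _≥_)
open import Data.Fin using (Fin)
open import Data.Bool using (Bool)
open import Data.List using (List; []; _∷_; map; foldr; _++_; concatMap)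
open import Data.List.Membership.Propositional using (_∈_)
open import Data.List.Relation.Unary.All using (All; []; _∷_) renaming (map to mapAll)
open import Data.List.Relation.Unary.Unique.Propositional using (Unique)
open import Data.List.Relation.Binary.Permutation.Propositional using (_↭_)
open import Data.List.Relation.Binary.Pointwise using (Pointwise)
open import Data.Product using (Σ; ∃; _×_; _,_; proj₁; proj₂)
open import Data.Sum using (_⊎_)
open import Relation.Nullary using (¬_)
open import Relation.Binary.PropositionalEquality using (_≡_)
open import Relation.Binary.Structures using (IsStrictTotalOrder)
open import Induction.WellFounded using (WellFounded)

data Ty (NB : ℕ) : Set where
  base : Fin NB → Ty NB
  o    : Ty NB
  _⇒_  : Ty NB → Ty NB → Ty NB

infixr 20 _⇒_ _⇒f_

data FOTy (NB : ℕ) : Set where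
  fbase : Fin NB → FOTy NB
  _⇒f_  : FOTy NB → FOTy NB → FOTy NB

⌊_⌋ : ∀ {NB} → FOTy NB → Ty NB
⌊ fbase b ⌋ = base b
⌊ α ⇒f β ⌋ = ⌊ α ⌋ ⇒ ⌊ β ⌋

-- A signature: the number of base types and the non-logical constants
-- of each type (the logical constants are built into the term syntax).
record Signature : Set₁ where
  field
    NB    : ℕ
    Const : Ty NB → Set

module LD (Sg : Signature) where
  open Signature Sg

  Type : Set
  Type = Ty NB

  FO : Set
  FO = FOTy NB

  Ctx : Set
  Ctx = List Type

  VCtx : Set
  VCtx = List FO

  ⟦_⟧ : VCtx → Ctx
  ⟦ X ⟧ = map ⌊_⌋ X

  data _∋_ : Ctx → Type → Set where
    here  : ∀ {Γ τ} → (τ ∷ Γ) ∋ τ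
    there : ∀ {Γ σ τ} → Γ ∋ τ → (σ ∷ Γ) ∋ τ

  idx : ∀ {Γ τ} → Γ ∋ τ → ℕ
  idx here      = zero
  idx (there x) = suc (idx x)

  -- Simply typed λ-terms (α-equivalence is built in by de Bruijn indices).
  -- Nominal constants: for each first-order type α and each i : ℕ, nom α i.
  data Tm (Γ : Ctx) : Type → Set where
    var    : ∀ {τ} → Γ ∋ τ → Tm Γ τ
    con    : ∀ {τ} → Const τ → Tm Γ τ
    nom    : (α : FO) → ℕ → Tm Γ ⌊ α ⌋
    lam    : ∀ {σ τ} → Tm (σ ∷ Γ) τ → Tm Γ (σ ⇒ τ)
    app    : ∀ {σ τ} → Tm Γ (σ ⇒ τ) → Tm Γ σ → Tm Γ τ
    botC   : Tm Γ o
    topC   : Tm Γ o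
    andC   : Tm Γ (o ⇒ o ⇒ o)
    orC    : Tm Γ (o ⇒ o ⇒ o)
    impC   : Tm Γ (o ⇒ o ⇒ o)
    allC   : (α : FO) → Tm Γ ((⌊ α ⌋ ⇒ o) ⇒ o)
    exC    : (α : FO) → Tm Γ ((⌊ α ⌋ ⇒ o) ⇒ o)
    nablaC : (α : FO) → Tm Γ ((⌊ α ⌋ ⇒ o) ⇒ o)

  Ren : Ctx → Ctx → Set
  Ren Γ Δ = ∀ {τ} → Γ ∋ τ → Δ ∋ τ

  ext : ∀ {Γ Δ σ} → Ren Γ Δ → Ren (σ ∷ Γ) (σ ∷ Δ)
  ext ρ here      = here
  ext ρ (there x) = there (ρ x)

  rename : ∀ {Γ Δ τ} → Ren Γ Δ → Tm Γ τ → Tm Δ τ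
  rename ρ (var x)    = var (ρ x)
  rename ρ (con c)    = con c
  rename ρ (nom α i)  = nom α i
  rename ρ (lam t)    = lam (rename (ext ρ) t)
  rename ρ (app t u)  = app (rename ρ t) (rename ρ u)
  rename ρ botC       = botC
  rename ρ topC       = topC
  rename ρ andC       = andC
  rename ρ orC        = orC
  rename ρ impC       = impC
  rename ρ (allC α)   = allC α
  rename ρ (exC α)    = exC α
  rename ρ (nablaC α) = nablaC α

  wk : ∀ {Γ σ τ} → Tm Γ τ → Tm (σ ∷ Γ) τ
  wk = rename there

  wk0 : ∀ {Γ τ} → Tm [] τ → Tm Γ τ
  wk0 = rename (λ ())

  -- Sub Γ Δ assigns to every variable of Γ a term over Δ
  -- (in the paper's notation: θ : Δ → Γ).
  Sub : Ctx → Ctx → Set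
  Sub Γ Δ = ∀ {τ} → Γ ∋ τ → Tm Δ τ

  exts : ∀ {Γ Δ σ} → Sub Γ Δ → Sub (σ ∷ Γ) (σ ∷ Δ)
  exts θ here      = var here
  exts θ (there x) = wk (θ x)

  subst : ∀ {Γ Δ τ} → Sub Γ Δ → Tm Γ τ → Tm Δ τ
  subst θ (var x)    = θ x
  subst θ (con c)    = con c
  subst θ (nom α i)  = nom α i
  subst θ (lam t)    = lam (subst (exts θ) t)
  subst θ (app t u)  = app (subst θ t) (subst θ u)
  subst θ botC       = botC
  subst θ topC       = topC
  subst θ andC       = andC
  subst θ orC        = orC
  subst θ impC       = impC
  subst θ (allC α)   = allC α
  subst θ (exC α)    = exC α
  subst θ (nablaC α) = nablaC α

  ids : ∀ {Γ} → Sub Γ Γ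
  ids = var

  _[_] : ∀ {Γ σ τ} → Tm (σ ∷ Γ) τ → Tm Γ σ → Tm Γ τ
  t [ u ] = subst (λ { here → u ; (there x) → var x }) t

  infix 4 _≈_
  data _≈_ {Γ : Ctx} : ∀ {τ} → Tm Γ τ → Tm Γ τ → Set where
    ≈refl  : ∀ {τ} {t : Tm Γ τ} → t ≈ t
    ≈sym   : ∀ {τ} {t u : Tm Γ τ} → t ≈ u → u ≈ t
    ≈trans : ∀ {τ} {t u v : Tm Γ τ} → t ≈ u → u ≈ v → t ≈ v
    ≈app   : ∀ {σ τ} {t t' : Tm Γ (σ ⇒ τ)} {u u' : Tm Γ σ} →
             t ≈ t' → u ≈ u' → app t u ≈ app t' u'
    ≈lam   : ∀ {σ τ} {t t' : Tm (σ ∷ Γ) τ} → t ≈ t' → lam t ≈ lam t'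
    ≈β     : ∀ {σ τ} (t : Tm (σ ∷ Γ) τ) (u : Tm Γ σ) → app (lam t) u ≈ t [ u ]
    ≈η     : ∀ {σ τ} (t : Tm Γ (σ ⇒ τ)) → t ≈ lam (app (wk t) (var here))

  -- Occurrences (raw), and occurrence modulo αβη (= occurrence in the
  -- βη-normal form, i.e. in every convertible term).

  data OccN (α : FO) (i : ℕ) {Γ : Ctx} : ∀ {τ} → Tm Γ τ → Set where
    onom  : OccN α i (nom α i)
    oappl : ∀ {σ τ} {t : Tm Γ (σ ⇒ τ)} {u} → OccN α i t → OccN α i (app t u)
    oappr : ∀ {σ τ} {t : Tm Γ (σ ⇒ τ)} {u} → OccN α i u → OccN α i (app t u)
    olam  : ∀ {σ τ} {t : Tm (σ ∷ Γ) τ} → OccN α i t → OccN α i (lam t)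

  data OccV {Γ : Ctx} {ρ : Type} : (x : Γ ∋ ρ) → ∀ {τ} → Tm Γ τ → Set where
    ovar  : ∀ {x} → OccV x (var x)
    oappl : ∀ {x σ τ} {t : Tm Γ (σ ⇒ τ)} {u} → OccV x t → OccV x (app t u)
    oappr : ∀ {x σ τ} {t : Tm Γ (σ ⇒ τ)} {u} → OccV x u → OccV x (app t u)
    olam  : ∀ {x σ τ} {t : Tm (σ ∷ Γ) τ} → OccV (there x) t → OccV x (lam t)

  data OccC {ρ : Type} (c : Const ρ) {Γ : Ctx} : ∀ {τ} → Tm Γ τ → Set where
    ocon  : OccC c (con c)
    oappl : ∀ {σ τ} {t : Tm Γ (σ ⇒ τ)} {u} → OccC c t → OccC c (app t u)
    oappr : ∀ {σ τ} {t : Tm Γ (σ ⇒ τ)} {u} → OccC c u → OccC c (app t u)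
    olam  : ∀ {σ τ} {t : Tm (σ ∷ Γ) τ} → OccC c t → OccC c (lam t)

  InSupp : ∀ {Γ τ} → FO → ℕ → Tm Γ τ → Set
  InSupp α i t = ∀ t' → t' ≈ t → OccN α i t'

  EmptySupp : ∀ {Γ τ} → Tm Γ τ → Set
  EmptySupp t = ∀ α i → ¬ InSupp α i t

  VarOccurs : ∀ {Γ ρ τ} → Γ ∋ ρ → Tm Γ τ → Set
  VarOccurs x t = ∀ t' → t' ≈ t → OccV x t'

  -- Nominal permutations (type preserving: a bijection on the nominals
  -- of each type) and their action F[π].

  record Perm : Set where
    field
      fun  : FO → ℕ → ℕ
      inv  : FO → ℕ → ℕ
      invˡ : ∀ α i → inv α (fun α i) ≡ i
      invʳ : ∀ α i → fun α (inv α i) ≡ i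
  open Perm public

  mapNom : ∀ {Γ τ} → (FO → ℕ → ℕ) → Tm Γ τ → Tm Γ τ
  mapNom f (var x)    = var x
  mapNom f (con c)    = con c
  mapNom f (nom α i)  = nom α (f α i)
  mapNom f (lam t)    = lam (mapNom f t)
  mapNom f (app t u)  = app (mapNom f t) (mapNom f u)
  mapNom f botC       = botC
  mapNom f topC       = topC
  mapNom f andC       = andC
  mapNom f orC        = orC
  mapNom f impC       = impC
  mapNom f (allC α)   = allC α
  mapNom f (exC α)    = exC α
  mapNom f (nablaC α) = nablaC α

  _⟪_⟫ : ∀ {Γ τ} → Tm Γ τ → Perm → Tm Γ τ
  t ⟪ π ⟫ = mapNom (fun π) t

  -- π is a permutation of supp(t): it fixes every nominal outside supp(t)
  -- (hence, being a bijection, it maps supp(t) onto itself).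
  PermOf : ∀ {Γ τ} → Perm → Tm Γ τ → Set
  PermOf π t = ∀ α i → ¬ InSupp α i t → fun π α i ≡ i

  data Atomic {Γ : Ctx} : ∀ {τ} → Tm Γ τ → Set where
    acon : ∀ {τ} (c : Const τ) → Atomic (con c)
    aapp : ∀ {σ τ} {t : Tm Γ (σ ⇒ τ)} {u} → Atomic t → Atomic (app t u)

  data HeadedBy {ρ : Type} (c : Const ρ) {Γ : Ctx} : ∀ {τ} → Tm Γ τ → Set where
    hcon : HeadedBy c (con c)
    happ : ∀ {σ τ} {t : Tm Γ (σ ⇒ τ)} {u} → HeadedBy c t → HeadedBy c (app t u)

  -- Higher-order patterns (β-normal; free variables applied to distinct
  -- bound variables).  In  PatT n t  the first n entries of the context
  -- are bound (λ-bound) variables; the rest are the free variables.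
  mutual
    data Rigid {Γ : Ctx} (n : ℕ) : ∀ {τ} → Tm Γ τ → Set where
      rcon   : ∀ {τ} (c : Const τ) → Rigid n (con c)
      rnom   : ∀ α i → Rigid n (nom α i)
      rbvar  : ∀ {τ} (x : Γ ∋ τ) → idx x < n → Rigid n (var x)
      rbot   : Rigid n botC
      rtop   : Rigid n topC
      rand   : Rigid n andC
      ror    : Rigid n orC
      rimp   : Rigid n impC
      rall   : ∀ α → Rigid n (allC α)
      rex    : ∀ α → Rigid n (exC α)
      rnabla : ∀ α → Rigid n (nablaC α)
      rapp   : ∀ {σ τ} {t : Tm Γ (σ ⇒ τ)} {u} → Rigid n t → PatT n u → Rigid n (app t u)

    data Flex {Γ : Ctx} (n : ℕ) : List ℕ → ∀ {τ} → Tm Γ τ → Set where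
      fvar : ∀ {τ} (x : Γ ∋ τ) → idx x ≥ n → Flex n [] (var x)
      fapp : ∀ {σ τ is} {t : Tm Γ (σ ⇒ τ)} (w : Γ ∋ σ) → Flex n is t →
             idx w < n → ¬ (idx w ∈ is) → Flex n (idx w ∷ is) (app t (var w))

    data PatT {Γ : Ctx} (n : ℕ) : ∀ {τ} → Tm Γ τ → Set where
      plam   : ∀ {σ τ} {t : Tm (σ ∷ Γ) τ} → PatT (suc n) t → PatT n (lam t)
      prigid : ∀ {τ} {t : Tm Γ τ} → Rigid n t → PatT n t
      pflex  : ∀ {τ is} {t : Tm Γ τ} → Flex n is t → PatT n t

  HOPattern : ∀ {Γ τ} → Tm Γ τ → Set
  HOPattern t = Σ _ λ t' → (t' ≈ t) × PatT 0 t'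

  record Clause : Set where
    field
      cctx : VCtx
      head : Tm ⟦ cctx ⟧ o
      body : Tm ⟦ cctx ⟧ o
  open Clause public

  ValidClause : Clause → Set
  ValidClause cl =
    Atomic (head cl) × EmptySupp (head cl) × EmptySupp (body cl) ×
    (∀ {τ} (x : ⟦ cctx cl ⟧ ∋ τ) → VarOccurs x (head cl)) ×
    HOPattern (head cl)

  record DefSet : Set₁ where
    field
      DIdx   : Set
      clause : DIdx → Clause
  open DefSet public

  ValidD : DefSet → Set
  ValidD D = ∀ k → ValidClause (clause D k)

  Defn : ∀ {Y Z} → Clause → Tm ⟦ Y ⟧ o → Sub ⟦ Y ⟧ ⟦ Z ⟧ → Tm ⟦ Z ⟧ o → Set
  Defn {Y} {Z} cl A θ B' =
    Σ (Sub ⟦ cctx cl ⟧ ⟦ Z ⟧) λ ρ →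
      (subst ρ (head cl) ≈ subst θ A) × (B' ≈ subst ρ (body cl))

  DefinedIn : ∀ {Γ} → DefSet → Tm Γ o → Set
  DefinedIn D A = Σ Type λ ρ → Σ (Const ρ) λ p →
    HeadedBy p A × Σ (DIdx D) λ k → HeadedBy p (head (clause D k))

  EmptySuppSub : ∀ {Γ Δ} → Sub Γ Δ → Set
  EmptySuppSub θ = ∀ {τ} (x : _ ∋ τ) → EmptySupp (θ x)

  RangeIs : ∀ {Γ Δ} → Sub Γ Δ → Set
  RangeIs {Γ} {Δ} θ = ∀ {ρ} (z : Δ ∋ ρ) → Σ Type λ τ → Σ (Γ ∋ τ) λ x → VarOccurs z (θ x)

  predTy : VCtx → Type
  predTy as = foldr (λ α t → ⌊ α ⌋ ⇒ t) o as

  Args : Ctx → VCtx → Set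
  Args Γ as = All (λ α → Tm Γ ⌊ α ⌋) as

  spine : ∀ {Γ as} → Tm Γ (predTy as) → Args Γ as → Tm Γ o
  spine t []       = t
  spine t (u ∷ us) = spine (app t u) us

  allVars : (as : VCtx) → Args ⟦ as ⟧ as
  allVars []       = []
  allVars (α ∷ as) = var here ∷ mapAll wk (allVars as)

  record IClause : Set where
    field
      iargs : VCtx
      ipred : Const (predTy iargs)
      ibody : Tm [] (predTy iargs ⇒ predTy iargs)
  open IClause public

  record IndSet : Set₁ where
    field
      IIdx    : Set
      iclause : IIdx → IClause
  open IndSet public

  ValidI : IndSet → DefSet → Set
  ValidI I D =
    (∀ k → Σ _ λ B' → (B' ≈ ibody (iclause I k)) × ¬ OccC (ipred (iclause I k)) B') ×
    -- p heads at most one clause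
    (∀ k k' → _≡_ {A = Σ Type Const}
                  (predTy (iargs (iclause I k)) , ipred (iclause I k))
                  (predTy (iargs (iclause I k')) , ipred (iclause I k')) → k ≡ k') ×
    (∀ k j → ¬ HeadedBy (ipred (iclause I k)) (head (clause D j)))

  -- Levels.  An ordinal level assignment is modelled by a well-ordered
  -- type O (strict total, well-founded order) and a map on ground atoms
  -- (lvl is only consulted on atomic formulas).

  record LevelAssignment : Set₁ where
    field
      O     : Set
      _<O_  : O → O → Set
      isSTO : IsStrictTotalOrder _≡_ _<O_
      wf    : WellFounded _<O_
      lvl   : Tm [] o → O
      lvl≈  : ∀ {A A'} → Atomic A → A ≈ A' → lvl A ≡ lvl A'

    _≤O_ : O → O → Set
    a ≤O b = (a <O b) ⊎ (a ≡ b)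

    -- LvlLe F a  ⇔  lvl(F) ≤ a   (F ground)
    data LvlLe : Tm [] o → O → Set where
      lbot  : ∀ {a} → LvlLe botC a
      ltop  : ∀ {a} → LvlLe topC a
      latom : ∀ {A a} → Atomic A → lvl A ≤O a → LvlLe A a
      land  : ∀ {A B a} → LvlLe A a → LvlLe B a → LvlLe (app (app andC A) B) a
      lor   : ∀ {A B a} → LvlLe A a → LvlLe B a → LvlLe (app (app orC A) B) a
      limp  : ∀ {A B a} b → b <O a → LvlLe A b → LvlLe B a →
              LvlLe (app (app impC A) B) a
      lall  : ∀ {α C a} → (∀ (t : Tm [] ⌊ α ⌋) → LvlLe (app C t) a) →
              LvlLe (app (allC α) C) a
      lex   : ∀ {α C a} → (∀ (t : Tm [] ⌊ α ⌋) → LvlLe (app C t) a) →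
              LvlLe (app (exC α) C) a
      lnabla : ∀ {α C a} i → ¬ InSupp α i C → LvlLe (app C (nom α i)) a →
               LvlLe (app (nablaC α) C) a
      lconv : ∀ {F F' a} → LvlLe F a → F ≈ F' → LvlLe F' a

  WeaklyStratified : LevelAssignment → DefSet → Set
  WeaklyStratified L D = ∀ k (ρ : Sub ⟦ cctx (clause D k) ⟧ []) →
    LvlLe (subst ρ (body (clause D k))) (lvl (subst ρ (head (clause D k))))
    where open LevelAssignment L

  StrictlyStratified : LevelAssignment → IndSet → Set
  StrictlyStratified L I = ∀ k →
    (∀ (ts ts' : Args [] (iargs (iclause I k))) →
       lvl (spine (con (ipred (iclause I k))) ts) ≡ lvl (spine (con (ipred (iclause I k))) ts')) ×
    (∀ (ts : Args [] (iargs (iclause I k))) →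
       LvlLe (spine (app (ibody (iclause I k)) (con (ipred (iclause I k)))) ts)
             (lvl (spine (con (ipred (iclause I k))) ts)))
    where open LevelAssignment L

  Stratified : DefSet → IndSet → Set₁
  Stratified D I = Σ LevelAssignment λ L → WeaklyStratified L D × StrictlyStratified L I

  data Mode : Set where
    cutFree full : Mode

  -- ∀R / ∃L: raising the fresh variable over the support
  raiseTy : List (Σ FO λ _ → ℕ) → FO → FO
  raiseTy []             τ = τ
  raiseTy ((α , _) ∷ ns) τ = α ⇒f raiseTy ns τ

  applyNoms : ∀ {Γ τ} (ns : List (Σ FO λ _ → ℕ)) → Tm Γ ⌊ raiseTy ns τ ⌋ → Tm Γ ⌊ τ ⌋
  applyNoms []             t = t
  applyNoms ((α , i) ∷ ns) t = applyNoms ns (app t (nom α i))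

  Lists : ∀ {Γ τ} → List (Σ FO λ _ → ℕ) → Tm Γ τ → Set
  Lists ns C = Unique ns ×
    (∀ α i → ((α , i) ∈ ns → InSupp α i C) × (InSupp α i C → (α , i) ∈ ns))

  _≋_ : ∀ {Γ} → List (Tm Γ o) → List (Tm Γ o) → Set
  Γ₁ ≋ Γ₂ = Σ _ λ Δ → (Γ₁ ↭ Δ) × Pointwise _≈_ Δ Γ₂

  data Deriv (D : DefSet) (I : IndSet) : Mode → (X : VCtx) → List (Tm ⟦ X ⟧ o) → Tm ⟦ X ⟧ o → Set where
    -- formulas and contexts are taken modulo αβη and as multisets
    conv  : ∀ {m X Γ Γ' C C'} → Deriv D I m X Γ C → Γ ≋ Γ' → C ≈ C' → Deriv D I m X Γ' C'
    botL  : ∀ {m X Γ B} → Deriv D I m X (botC ∷ Γ) B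
    topR  : ∀ {m X Γ} → Deriv D I m X Γ topC
    impL  : ∀ {m X Γ B C E} → Deriv D I m X Γ B → Deriv D I m X (C ∷ Γ) E →
            Deriv D I m X (app (app impC B) C ∷ Γ) E
    impR  : ∀ {m X Γ B C} → Deriv D I m X (B ∷ Γ) C → Deriv D I m X Γ (app (app impC B) C)
    andL₁ : ∀ {m X Γ B C E} → Deriv D I m X (B ∷ Γ) E → Deriv D I m X (app (app andC B) C ∷ Γ) E
    andL₂ : ∀ {m X Γ B C E} → Deriv D I m X (C ∷ Γ) E → Deriv D I m X (app (app andC B) C ∷ Γ) E
    andR  : ∀ {m X Γ B C} → Deriv D I m X Γ B → Deriv D I m X Γ C → Deriv D I m X Γ (app (app andC B) C)
    orL   : ∀ {m X Γ B C E} → Deriv D I m X (B ∷ Γ) E → Deriv D I m X (C ∷ Γ) E →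
            Deriv D I m X (app (app orC B) C ∷ Γ) E
    orR₁  : ∀ {m X Γ B C} → Deriv D I m X Γ B → Deriv D I m X Γ (app (app orC B) C)
    orR₂  : ∀ {m X Γ B C} → Deriv D I m X Γ C → Deriv D I m X Γ (app (app orC B) C)
    allL  : ∀ {m X Γ τ E} {C : Tm ⟦ X ⟧ (⌊ τ ⌋ ⇒ o)} (t : Tm ⟦ X ⟧ ⌊ τ ⌋) →
            Deriv D I m X (app C t ∷ Γ) E → Deriv D I m X (app (allC τ) C ∷ Γ) E
    allR  : ∀ {m X Γ τ} {C : Tm ⟦ X ⟧ (⌊ τ ⌋ ⇒ o)} (ns : List (Σ FO λ _ → ℕ)) → Lists ns C →
            Deriv D I m (raiseTy ns τ ∷ X) (map wk Γ) (app (wk C) (applyNoms ns (var here))) →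
            Deriv D I m X Γ (app (allC τ) C)
    exL   : ∀ {m X Γ τ E} {C : Tm ⟦ X ⟧ (⌊ τ ⌋ ⇒ o)} (ns : List (Σ FO λ _ → ℕ)) → Lists ns C →
            Deriv D I m (raiseTy ns τ ∷ X) (app (wk C) (applyNoms ns (var here)) ∷ map wk Γ) (wk E) →
            Deriv D I m X (app (exC τ) C ∷ Γ) E
    exR   : ∀ {m X Γ τ} {C : Tm ⟦ X ⟧ (⌊ τ ⌋ ⇒ o)} (t : Tm ⟦ X ⟧ ⌊ τ ⌋) →
            Deriv D I m X Γ (app C t) → Deriv D I m X Γ (app (exC τ) C)
    nablaL : ∀ {m X Γ τ E} {C : Tm ⟦ X ⟧ (⌊ τ ⌋ ⇒ o)} (i : ℕ) → ¬ InSupp τ i C →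
            Deriv D I m X (app C (nom τ i) ∷ Γ) E → Deriv D I m X (app (nablaC τ) C ∷ Γ) E
    nablaR : ∀ {m X Γ τ} {C : Tm ⟦ X ⟧ (⌊ τ ⌋ ⇒ o)} (i : ℕ) → ¬ InSupp τ i C →
            Deriv D I m X Γ (app C (nom τ i)) → Deriv D I m X Γ (app (nablaC τ) C)
    cL    : ∀ {m X Γ B E} → Deriv D I m X (B ∷ B ∷ Γ) E → Deriv D I m X (B ∷ Γ) E
    wL    : ∀ {m X Γ B E} → Deriv D I m X Γ E → Deriv D I m X (B ∷ Γ) E
    init  : ∀ {m X} {A : Tm ⟦ X ⟧ o} → Atomic A → (π : Perm) → Deriv D I m X (A ∷ []) (A ⟪ π ⟫)
    mc    : ∀ {X Γ C} (ps : List (Σ (List (Tm ⟦ X ⟧ o)) λ _ → Tm ⟦ X ⟧ o)) →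
            All (λ p → Deriv D I full X (proj₁ p) (proj₂ p)) ps →
            Deriv D I full X (Γ ++ map proj₂ ps) C →
            Deriv D I full X (Γ ++ concatMap proj₁ ps) C
    defL  : ∀ {m Y Γ C} (A : Tm ⟦ Y ⟧ o) → DefinedIn D A →
            (∀ k (Z : VCtx) (θ : Sub ⟦ Y ⟧ ⟦ Z ⟧) → EmptySuppSub θ → RangeIs θ →
               (B' : Tm ⟦ Z ⟧ o) → Defn (clause D k) A θ B' →
               Deriv D I m Z (B' ∷ map (subst θ) Γ) (subst θ C)) →
            Deriv D I m Y (A ∷ Γ) C
    defR  : ∀ {m Y Γ} (A : Tm ⟦ Y ⟧ o) k (B' : Tm ⟦ Y ⟧ o) → Defn (clause D k) A ids B' →
            Deriv D I m Y Γ B' → Deriv D I m Y Γ A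
    muL   : ∀ {m X Γ C} k (S : Tm [] (predTy (iargs (iclause I k))))
            (ts : Args ⟦ X ⟧ (iargs (iclause I k))) →
            Deriv D I m (iargs (iclause I k))
              (spine (app (wk0 (ibody (iclause I k))) (wk0 S)) (allVars (iargs (iclause I k))) ∷ [])
              (spine (wk0 S) (allVars (iargs (iclause I k)))) →
            Deriv D I m X (spine (wk0 S) ts ∷ Γ) C →
            Deriv D I m X (spine (con (ipred (iclause I k))) ts ∷ Γ) C
    muR   : ∀ {m X Γ} k (ts : Args ⟦ X ⟧ (iargs (iclause I k))) →
            Deriv D I m X Γ (spine (app (wk0 (ibody (iclause I k))) (con (ipred (iclause I k)))) ts) →
            Deriv D I m X Γ (spine (con (ipred (iclause I k))) ts)

{-# OPTIONS --safe #-}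
module Submission where

-- By induction on the logical depth of B, every
-- connective of B is unfolded by its right and left rules, down to atoms,
-- where init accepts any permutation.  Since formulas are taken modulo αβη,
-- the induction runs on a β-normal form of B, which exists by a Tait-style
-- reducibility argument.  The rules ∀R and ∃L also ask for supp(C) as an
-- explicit list, where supp is occurrence in every αβη-convertible term.
-- The candidate list is the nominals of a normal form of C; that each of
-- them occurs in every term convertible to C follows from a Boolean model,
-- invariant under αβη, in which the value of a term records whether a
-- chosen nominal occurs in it.

open import Defs
open import Data.Bool using (Bool; true; false; _∨_)
open import Data.Bool.Properties using (∨-identityʳ; ∨-zeroʳ)
open import Data.Empty using (⊥-elim)
open import Data.Fin using () renaming (_≟_ to _≟Fin_)
open import Data.List using (List; []; _∷_; _++_; deduplicate)
open import Data.List.Membership.Propositional using (_∈_)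
open import Data.List.Membership.Propositional.Properties using (∈-++⁺ˡ; ∈-++⁺ʳ; ∈-++⁻; ∈-deduplicate⁺; ∈-deduplicate⁻)
open import Data.List.Relation.Unary.Any as Any using ()
open import Data.List.Relation.Unary.Unique.DecPropositional.Properties using (deduplicate-!)
open import Data.List.Relation.Binary.Permutation.Propositional using (swap) renaming (refl to ↭-refl)
open import Data.List.Relation.Binary.Pointwise as Pointwise using ([]; _∷_)
open import Data.Nat using (ℕ; suc; _≤_; _⊔_; _≤′_; ≤′-refl; ≤′-step) renaming (_≟_ to _≟ℕ_)
open import Data.Nat.Properties using (≤-refl; ≤-trans; m≤m⊔n; m≤n⊔m; <-irrefl; ≤⇒≤′)
open import Data.Product using (Σ; _×_; _,_; proj₁; proj₂)
open import Data.Product.Properties using (≡-dec)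
open import Data.Sum using (inj₁; inj₂)
open import Relation.Nullary using (¬_; Dec; yes; no; does)
open import Relation.Nullary.Decidable using (dec-true)
open import Relation.Binary.PropositionalEquality using (_≡_; refl; sym; trans; cong; cong₂; module ≡-Reasoning) renaming (subst to transport)

module Metatheory (Sg : Signature) where
  open Signature Sg
  open LD Sg
  open ≡-Reasoning

  variable
    Γ Δ E : Ctx
    σ τ : Type
    X : VCtx

  -- Renaming and substitution

  ≡⇒≈ : {t u : Tm Γ τ} → t ≡ u → t ≈ u
  ≡⇒≈ refl = ≈refl

  ext-cong : {ρ ρ' : Ren Γ Δ} → (∀ {τ} (x : Γ ∋ τ) → ρ x ≡ ρ' x) →
             (x : (σ ∷ Γ) ∋ τ) → ext ρ x ≡ ext ρ' x
  ext-cong h here      = refl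
  ext-cong h (there x) = cong there (h x)

  rename-cong : {ρ ρ' : Ren Γ Δ} → (∀ {τ} (x : Γ ∋ τ) → ρ x ≡ ρ' x) →
                (t : Tm Γ τ) → rename ρ t ≡ rename ρ' t
  rename-cong h (var x)    = cong var (h x)
  rename-cong h (con c)    = refl
  rename-cong h (nom α i)  = refl
  rename-cong h (lam t)    = cong lam (rename-cong (ext-cong h) t)
  rename-cong h (app t u)  = cong₂ app (rename-cong h t) (rename-cong h u)
  rename-cong h botC       = refl
  rename-cong h topC       = refl
  rename-cong h andC       = refl
  rename-cong h orC        = refl
  rename-cong h impC       = refl
  rename-cong h (allC α)   = refl
  rename-cong h (exC α)    = refl
  rename-cong h (nablaC α) = refl

  rename-rename : (ρ : Ren Γ Δ) (ρ' : Ren Δ E) (t : Tm Γ τ) →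
                  rename ρ' (rename ρ t) ≡ rename (λ x → ρ' (ρ x)) t
  rename-rename ρ ρ' (var x)    = refl
  rename-rename ρ ρ' (con c)    = refl
  rename-rename ρ ρ' (nom α i)  = refl
  rename-rename ρ ρ' (lam t)    =
    cong lam (trans (rename-rename (ext ρ) (ext ρ') t) (rename-cong (λ { here → refl ; (there x) → refl }) t))
  rename-rename ρ ρ' (app t u)  = cong₂ app (rename-rename ρ ρ' t) (rename-rename ρ ρ' u)
  rename-rename ρ ρ' botC       = refl
  rename-rename ρ ρ' topC       = refl
  rename-rename ρ ρ' andC       = refl
  rename-rename ρ ρ' orC        = refl
  rename-rename ρ ρ' impC       = refl
  rename-rename ρ ρ' (allC α)   = refl
  rename-rename ρ ρ' (exC α)    = refl
  rename-rename ρ ρ' (nablaC α) = refl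

  rename-id : (t : Tm Γ τ) → rename (λ x → x) t ≡ t
  rename-id (var x)    = refl
  rename-id (con c)    = refl
  rename-id (nom α i)  = refl
  rename-id (lam t)    = cong lam (trans (rename-cong (λ { here → refl ; (there x) → refl }) t) (rename-id t))
  rename-id (app t u)  = cong₂ app (rename-id t) (rename-id u)
  rename-id botC       = refl
  rename-id topC       = refl
  rename-id andC       = refl
  rename-id orC        = refl
  rename-id impC       = refl
  rename-id (allC α)   = refl
  rename-id (exC α)    = refl
  rename-id (nablaC α) = refl

  rename-wk : (ρ : Ren Γ Δ) (t : Tm Γ τ) → rename (ext {σ = σ} ρ) (wk t) ≡ wk (rename ρ t)
  rename-wk ρ t = trans (rename-rename there (ext ρ) t) (sym (rename-rename ρ there t))

  exts-cong : {θ θ' : Sub Γ Δ} → (∀ {τ} (x : Γ ∋ τ) → θ x ≡ θ' x) →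
              (x : (σ ∷ Γ) ∋ τ) → exts θ x ≡ exts θ' x
  exts-cong h here      = refl
  exts-cong h (there x) = cong wk (h x)

  subst-cong : {θ θ' : Sub Γ Δ} → (∀ {τ} (x : Γ ∋ τ) → θ x ≡ θ' x) →
               (t : Tm Γ τ) → subst θ t ≡ subst θ' t
  subst-cong h (var x)    = h x
  subst-cong h (con c)    = refl
  subst-cong h (nom α i)  = refl
  subst-cong h (lam t)    = cong lam (subst-cong (exts-cong h) t)
  subst-cong h (app t u)  = cong₂ app (subst-cong h t) (subst-cong h u)
  subst-cong h botC       = refl
  subst-cong h topC       = refl
  subst-cong h andC       = refl
  subst-cong h orC        = refl
  subst-cong h impC       = refl
  subst-cong h (allC α)   = refl
  subst-cong h (exC α)    = refl
  subst-cong h (nablaC α) = refl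

  subst-rename : (ρ : Ren Γ Δ) (θ : Sub Δ E) (t : Tm Γ τ) →
                 subst θ (rename ρ t) ≡ subst (λ x → θ (ρ x)) t
  subst-rename ρ θ (var x)    = refl
  subst-rename ρ θ (con c)    = refl
  subst-rename ρ θ (nom α i)  = refl
  subst-rename ρ θ (lam t)    =
    cong lam (trans (subst-rename (ext ρ) (exts θ) t) (subst-cong (λ { here → refl ; (there x) → refl }) t))
  subst-rename ρ θ (app t u)  = cong₂ app (subst-rename ρ θ t) (subst-rename ρ θ u)
  subst-rename ρ θ botC       = refl
  subst-rename ρ θ topC       = refl
  subst-rename ρ θ andC       = refl
  subst-rename ρ θ orC        = refl
  subst-rename ρ θ impC       = refl
  subst-rename ρ θ (allC α)   = refl
  subst-rename ρ θ (exC α)    = refl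
  subst-rename ρ θ (nablaC α) = refl

  rename-subst : (θ : Sub Γ Δ) (ρ : Ren Δ E) (t : Tm Γ τ) →
                 rename ρ (subst θ t) ≡ subst (λ x → rename ρ (θ x)) t
  rename-subst θ ρ (var x)    = refl
  rename-subst θ ρ (con c)    = refl
  rename-subst θ ρ (nom α i)  = refl
  rename-subst θ ρ (lam t)    =
    cong lam (trans (rename-subst (exts θ) (ext ρ) t)
                    (subst-cong (λ { here → refl ; (there x) → rename-wk ρ (θ x) }) t))
  rename-subst θ ρ (app t u)  = cong₂ app (rename-subst θ ρ t) (rename-subst θ ρ u)
  rename-subst θ ρ botC       = refl
  rename-subst θ ρ topC       = refl
  rename-subst θ ρ andC       = refl
  rename-subst θ ρ orC        = refl
  rename-subst θ ρ impC       = refl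
  rename-subst θ ρ (allC α)   = refl
  rename-subst θ ρ (exC α)    = refl
  rename-subst θ ρ (nablaC α) = refl

  subst-wk : (θ : Sub Γ Δ) (t : Tm Γ τ) → subst (exts {σ = σ} θ) (wk t) ≡ wk (subst θ t)
  subst-wk θ t = trans (subst-rename there (exts θ) t) (sym (rename-subst θ there t))

  subst-subst : (θ : Sub Γ Δ) (θ' : Sub Δ E) (t : Tm Γ τ) →
                subst θ' (subst θ t) ≡ subst (λ x → subst θ' (θ x)) t
  subst-subst θ θ' (var x)    = refl
  subst-subst θ θ' (con c)    = refl
  subst-subst θ θ' (nom α i)  = refl
  subst-subst θ θ' (lam t)    =
    cong lam (trans (subst-subst (exts θ) (exts θ') t)
                    (subst-cong (λ { here → refl ; (there x) → subst-wk θ' (θ x) }) t))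
  subst-subst θ θ' (app t u)  = cong₂ app (subst-subst θ θ' t) (subst-subst θ θ' u)
  subst-subst θ θ' botC       = refl
  subst-subst θ θ' topC       = refl
  subst-subst θ θ' andC       = refl
  subst-subst θ θ' orC        = refl
  subst-subst θ θ' impC       = refl
  subst-subst θ θ' (allC α)   = refl
  subst-subst θ θ' (exC α)    = refl
  subst-subst θ θ' (nablaC α) = refl

  subst-var : (ρ : Ren Γ Δ) (t : Tm Γ τ) → subst (λ x → var (ρ x)) t ≡ rename ρ t
  subst-var ρ (var x)    = refl
  subst-var ρ (con c)    = refl
  subst-var ρ (nom α i)  = refl
  subst-var ρ (lam t)    =
    cong lam (trans (subst-cong (λ { here → refl ; (there x) → refl }) t) (subst-var (ext ρ) t))
  subst-var ρ (app t u)  = cong₂ app (subst-var ρ t) (subst-var ρ u)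
  subst-var ρ botC       = refl
  subst-var ρ topC       = refl
  subst-var ρ andC       = refl
  subst-var ρ orC        = refl
  subst-var ρ impC       = refl
  subst-var ρ (allC α)   = refl
  subst-var ρ (exC α)    = refl
  subst-var ρ (nablaC α) = refl

  subst-id : (t : Tm Γ τ) → subst var t ≡ t
  subst-id t = trans (subst-var (λ x → x) t) (rename-id t)

  cons : Tm Δ σ → Sub Γ Δ → Sub (σ ∷ Γ) Δ
  cons u θ here      = u
  cons u θ (there x) = θ x

  []≡subst-cons : (t : Tm (σ ∷ Γ) τ) (u : Tm Γ σ) → t [ u ] ≡ subst (cons u var) t
  []≡subst-cons t u = subst-cong (λ { here → refl ; (there x) → refl }) t

  subst-exts-[] : (θ : Sub Γ Δ) (t : Tm (σ ∷ Γ) τ) (u : Tm Δ σ) →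
                  subst (exts θ) t [ u ] ≡ subst (cons u θ) t
  subst-exts-[] θ t u = begin
    subst (exts θ) t [ u ]                             ≡⟨ []≡subst-cons (subst (exts θ) t) u ⟩
    subst (cons u var) (subst (exts θ) t)              ≡⟨ subst-subst (exts θ) (cons u var) t ⟩
    subst (λ x → subst (cons u var) (exts θ x)) t      ≡⟨ subst-cong cons-exts t ⟩
    subst (cons u θ) t                                 ∎
    where
      cons-exts : ∀ {τ} (x : (_ ∷ _) ∋ τ) → subst (cons u var) (exts θ x) ≡ cons u θ x
      cons-exts here      = refl
      cons-exts (there x) = trans (subst-rename there (cons u var) (θ x)) (subst-id (θ x))

  subst-[] : (θ : Sub Γ Δ) (t : Tm (σ ∷ Γ) τ) (u : Tm Γ σ) →
             subst (exts θ) t [ subst θ u ] ≡ subst θ (t [ u ])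
  subst-[] θ t u = begin
    subst (exts θ) t [ subst θ u ]                     ≡⟨ subst-exts-[] θ t (subst θ u) ⟩
    subst (cons (subst θ u) θ) t
      ≡⟨ subst-cong (λ { here → refl ; (there x) → refl }) t ⟩
    subst (λ x → subst θ (cons u var x)) t             ≡⟨ sym (subst-subst (cons u var) θ t) ⟩
    subst θ (subst (cons u var) t)                     ≡⟨ cong (subst θ) (sym ([]≡subst-cons t u)) ⟩
    subst θ (t [ u ])                                  ∎

  rename-exts : (θ : Sub Γ Δ) (ρ : Ren Δ E) (t : Tm (σ ∷ Γ) τ) →
                rename (ext ρ) (subst (exts θ) t) ≡ subst (exts (λ x → rename ρ (θ x))) t
  rename-exts θ ρ t =
    trans (rename-subst (exts θ) (ext ρ) t) (subst-cong (λ { here → refl ; (there x) → rename-wk ρ (θ x) }) t)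

  rename-[] : (ρ : Ren Γ Δ) (t : Tm (σ ∷ Γ) τ) (u : Tm Γ σ) →
              rename (ext ρ) t [ rename ρ u ] ≡ rename ρ (t [ u ])
  rename-[] ρ t u = begin
    rename (ext ρ) t [ rename ρ u ]                    ≡⟨ []≡subst-cons (rename (ext ρ) t) (rename ρ u) ⟩
    subst (cons (rename ρ u) var) (rename (ext ρ) t)   ≡⟨ subst-rename (ext ρ) (cons (rename ρ u) var) t ⟩
    subst (λ x → cons (rename ρ u) var (ext ρ x)) t
      ≡⟨ subst-cong (λ { here → refl ; (there x) → refl }) t ⟩
    subst (λ x → rename ρ (cons u var x)) t            ≡⟨ sym (rename-subst (cons u var) ρ t) ⟩
    rename ρ (subst (cons u var) t)                    ≡⟨ cong (rename ρ) (sym ([]≡subst-cons t u)) ⟩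
    rename ρ (t [ u ])                                 ∎

  unbind : Tm Γ (σ ⇒ τ) → Tm (σ ∷ Γ) τ
  unbind C = app (wk C) (var here)

  unbind-lam : (B : Tm (σ ∷ Γ) τ) → unbind (lam B) ≈ B
  unbind-lam B = ≈trans (≈β _ _) (≡⇒≈ (begin
    rename (ext there) B [ var here ]                  ≡⟨ []≡subst-cons (rename (ext there) B) (var here) ⟩
    subst (cons (var here) var) (rename (ext there) B) ≡⟨ subst-rename (ext there) (cons (var here) var) B ⟩
    subst (λ x → cons (var here) var (ext there x)) B
      ≡⟨ subst-cong (λ { here → refl ; (there x) → refl }) B ⟩
    subst var B                                        ≡⟨ subst-id B ⟩
    B                                                  ∎))

  ≈-rename : (ρ : Ren Γ Δ) {t u : Tm Γ τ} → t ≈ u → rename ρ t ≈ rename ρ u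
  ≈-rename ρ ≈refl        = ≈refl
  ≈-rename ρ (≈sym p)     = ≈sym (≈-rename ρ p)
  ≈-rename ρ (≈trans p q) = ≈trans (≈-rename ρ p) (≈-rename ρ q)
  ≈-rename ρ (≈app p q)   = ≈app (≈-rename ρ p) (≈-rename ρ q)
  ≈-rename ρ (≈lam p)     = ≈lam (≈-rename (ext ρ) p)
  ≈-rename ρ (≈β t u)     = ≈trans (≈β _ _) (≡⇒≈ (rename-[] ρ t u))
  ≈-rename ρ (≈η t)       = ≈trans (≈η _) (≈lam (≈app (≡⇒≈ (sym (rename-wk ρ t))) ≈refl))

  ≈-subst : (θ : Sub Γ Δ) {t u : Tm Γ τ} → t ≈ u → subst θ t ≈ subst θ u
  ≈-subst θ ≈refl        = ≈refl
  ≈-subst θ (≈sym p)     = ≈sym (≈-subst θ p)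
  ≈-subst θ (≈trans p q) = ≈trans (≈-subst θ p) (≈-subst θ q)
  ≈-subst θ (≈app p q)   = ≈app (≈-subst θ p) (≈-subst θ q)
  ≈-subst θ (≈lam p)     = ≈lam (≈-subst (exts θ) p)
  ≈-subst θ (≈β t u)     = ≈trans (≈β _ _) (≡⇒≈ (subst-[] θ t u))
  ≈-subst θ (≈η t)       = ≈trans (≈η _) (≈lam (≈app (≡⇒≈ (sym (subst-wk θ t))) ≈refl))

  -- Renaming nominals

  mapNom-rename : (f : FO → ℕ → ℕ) (ρ : Ren Γ Δ) (t : Tm Γ τ) →
                  mapNom f (rename ρ t) ≡ rename ρ (mapNom f t)
  mapNom-rename f ρ (var x)    = refl
  mapNom-rename f ρ (con c)    = refl
  mapNom-rename f ρ (nom α i)  = refl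
  mapNom-rename f ρ (lam t)    = cong lam (mapNom-rename f (ext ρ) t)
  mapNom-rename f ρ (app t u)  = cong₂ app (mapNom-rename f ρ t) (mapNom-rename f ρ u)
  mapNom-rename f ρ botC       = refl
  mapNom-rename f ρ topC       = refl
  mapNom-rename f ρ andC       = refl
  mapNom-rename f ρ orC        = refl
  mapNom-rename f ρ impC       = refl
  mapNom-rename f ρ (allC α)   = refl
  mapNom-rename f ρ (exC α)    = refl
  mapNom-rename f ρ (nablaC α) = refl

  mapNom-subst : (f : FO → ℕ → ℕ) (θ : Sub Γ Δ) (t : Tm Γ τ) →
                 mapNom f (subst θ t) ≡ subst (λ x → mapNom f (θ x)) (mapNom f t)
  mapNom-subst f θ (var x)    = refl
  mapNom-subst f θ (con c)    = refl
  mapNom-subst f θ (nom α i)  = refl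
  mapNom-subst f θ (lam t)    =
    cong lam (trans (mapNom-subst f (exts θ) t)
                    (subst-cong (λ { here → refl ; (there x) → mapNom-rename f there (θ x) }) (mapNom f t)))
  mapNom-subst f θ (app t u)  = cong₂ app (mapNom-subst f θ t) (mapNom-subst f θ u)
  mapNom-subst f θ botC       = refl
  mapNom-subst f θ topC       = refl
  mapNom-subst f θ andC       = refl
  mapNom-subst f θ orC        = refl
  mapNom-subst f θ impC       = refl
  mapNom-subst f θ (allC α)   = refl
  mapNom-subst f θ (exC α)    = refl
  mapNom-subst f θ (nablaC α) = refl

  mapNom-[] : (f : FO → ℕ → ℕ) (t : Tm (σ ∷ Γ) τ) (u : Tm Γ σ) →
              mapNom f t [ mapNom f u ] ≡ mapNom f (t [ u ])
  mapNom-[] f t u = begin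
    mapNom f t [ mapNom f u ]                          ≡⟨ []≡subst-cons (mapNom f t) (mapNom f u) ⟩
    subst (cons (mapNom f u) var) (mapNom f t)
      ≡⟨ subst-cong (λ { here → refl ; (there x) → refl }) (mapNom f t) ⟩
    subst (λ x → mapNom f (cons u var x)) (mapNom f t) ≡⟨ sym (mapNom-subst f (cons u var) t) ⟩
    mapNom f (subst (cons u var) t)                    ≡⟨ cong (mapNom f) (sym ([]≡subst-cons t u)) ⟩
    mapNom f (t [ u ])                                 ∎

  ≈-mapNom : (f : FO → ℕ → ℕ) {t u : Tm Γ τ} → t ≈ u → mapNom f t ≈ mapNom f u
  ≈-mapNom f ≈refl        = ≈refl
  ≈-mapNom f (≈sym p)     = ≈sym (≈-mapNom f p)
  ≈-mapNom f (≈trans p q) = ≈trans (≈-mapNom f p) (≈-mapNom f q)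
  ≈-mapNom f (≈app p q)   = ≈app (≈-mapNom f p) (≈-mapNom f q)
  ≈-mapNom f (≈lam p)     = ≈lam (≈-mapNom f p)
  ≈-mapNom f (≈β t u)     = ≈trans (≈β _ _) (≡⇒≈ (mapNom-[] f t u))
  ≈-mapNom f (≈η t)       = ≈trans (≈η _) (≈lam (≈app (≡⇒≈ (sym (mapNom-rename f there t))) ≈refl))

  mapNom-cong : {f g : FO → ℕ → ℕ} → (∀ α i → f α i ≡ g α i) → (t : Tm Γ τ) →
                mapNom f t ≡ mapNom g t
  mapNom-cong h (var x)    = refl
  mapNom-cong h (con c)    = refl
  mapNom-cong h (nom α i)  = cong (nom α) (h α i)
  mapNom-cong h (lam t)    = cong lam (mapNom-cong h t)
  mapNom-cong h (app t u)  = cong₂ app (mapNom-cong h t) (mapNom-cong h u)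
  mapNom-cong h botC       = refl
  mapNom-cong h topC       = refl
  mapNom-cong h andC       = refl
  mapNom-cong h orC        = refl
  mapNom-cong h impC       = refl
  mapNom-cong h (allC α)   = refl
  mapNom-cong h (exC α)    = refl
  mapNom-cong h (nablaC α) = refl

  mapNom-mapNom : (f g : FO → ℕ → ℕ) (t : Tm Γ τ) →
                  mapNom g (mapNom f t) ≡ mapNom (λ α i → g α (f α i)) t
  mapNom-mapNom f g (var x)    = refl
  mapNom-mapNom f g (con c)    = refl
  mapNom-mapNom f g (nom α i)  = refl
  mapNom-mapNom f g (lam t)    = cong lam (mapNom-mapNom f g t)
  mapNom-mapNom f g (app t u)  = cong₂ app (mapNom-mapNom f g t) (mapNom-mapNom f g u)
  mapNom-mapNom f g botC       = refl
  mapNom-mapNom f g topC       = refl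
  mapNom-mapNom f g andC       = refl
  mapNom-mapNom f g orC        = refl
  mapNom-mapNom f g impC       = refl
  mapNom-mapNom f g (allC α)   = refl
  mapNom-mapNom f g (exC α)    = refl
  mapNom-mapNom f g (nablaC α) = refl

  mapNom-id : (t : Tm Γ τ) → mapNom (λ α i → i) t ≡ t
  mapNom-id (var x)    = refl
  mapNom-id (con c)    = refl
  mapNom-id (nom α i)  = refl
  mapNom-id (lam t)    = cong lam (mapNom-id t)
  mapNom-id (app t u)  = cong₂ app (mapNom-id t) (mapNom-id u)
  mapNom-id botC       = refl
  mapNom-id topC       = refl
  mapNom-id andC       = refl
  mapNom-id orC        = refl
  mapNom-id impC       = refl
  mapNom-id (allC α)   = refl
  mapNom-id (exC α)    = refl
  mapNom-id (nablaC α) = refl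

  _⁻¹ : Perm → Perm
  π ⁻¹ = record { fun = inv π ; inv = fun π ; invˡ = invʳ π ; invʳ = invˡ π }

  ⟪⟫-inverseˡ : (π : Perm) (t : Tm Γ τ) → t ⟪ π ⟫ ⟪ π ⁻¹ ⟫ ≡ t
  ⟪⟫-inverseˡ π t = begin
    t ⟪ π ⟫ ⟪ π ⁻¹ ⟫                                   ≡⟨ mapNom-mapNom (fun π) (inv π) t ⟩
    mapNom (λ α i → inv π α (fun π α i)) t             ≡⟨ mapNom-cong (invˡ π) t ⟩
    mapNom (λ α i → i) t                               ≡⟨ mapNom-id t ⟩
    t                                                  ∎

  Atomic-rename : (ρ : Ren Γ Δ) {t : Tm Γ τ} → Atomic t → Atomic (rename ρ t)
  Atomic-rename ρ (acon c) = acon c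
  Atomic-rename ρ (aapp a) = aapp (Atomic-rename ρ a)

  Atomic-subst : (θ : Sub Γ Δ) {t : Tm Γ τ} → Atomic t → Atomic (subst θ t)
  Atomic-subst θ (acon c) = acon c
  Atomic-subst θ (aapp a) = aapp (Atomic-subst θ a)

  Atomic-mapNom : (f : FO → ℕ → ℕ) {t : Tm Γ τ} → Atomic t → Atomic (mapNom f t)
  Atomic-mapNom f (acon c) = acon c
  Atomic-mapNom f (aapp a) = aapp (Atomic-mapNom f a)

  -- Weak normalisation

  mutual
    data Ne {Γ : Ctx} : ∀ {τ} → Tm Γ τ → Set where
      nvar : (x : Γ ∋ τ) → Ne (var x)
      ncon : (c : Const τ) → Ne (con c)
      nnom : ∀ α i → Ne (nom α i)
      nbot : Ne botC
      ntop : Ne topC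
      nand : Ne andC
      nor  : Ne orC
      nimp : Ne impC
      nall : ∀ α → Ne (allC α)
      nex  : ∀ α → Ne (exC α)
      nnab : ∀ α → Ne (nablaC α)
      napp : {t : Tm Γ (σ ⇒ τ)} {u : Tm Γ σ} → Ne t → Nf u → Ne (app t u)

    data Nf {Γ : Ctx} : ∀ {τ} → Tm Γ τ → Set where
      nlam : {t : Tm (σ ∷ Γ) τ} → Nf t → Nf (lam t)
      nne  : {t : Tm Γ τ} → Ne t → Nf t

  mutual
    Ne-rename : (ρ : Ren Γ Δ) {t : Tm Γ τ} → Ne t → Ne (rename ρ t)
    Ne-rename ρ (nvar x)   = nvar (ρ x)
    Ne-rename ρ (ncon c)   = ncon c
    Ne-rename ρ (nnom α i) = nnom α i
    Ne-rename ρ nbot       = nbot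
    Ne-rename ρ ntop       = ntop
    Ne-rename ρ nand       = nand
    Ne-rename ρ nor        = nor
    Ne-rename ρ nimp       = nimp
    Ne-rename ρ (nall α)   = nall α
    Ne-rename ρ (nex α)    = nex α
    Ne-rename ρ (nnab α)   = nnab α
    Ne-rename ρ (napp n m) = napp (Ne-rename ρ n) (Nf-rename ρ m)

    Nf-rename : (ρ : Ren Γ Δ) {t : Tm Γ τ} → Nf t → Nf (rename ρ t)
    Nf-rename ρ (nlam n) = nlam (Nf-rename (ext ρ) n)
    Nf-rename ρ (nne n)  = nne (Ne-rename ρ n)

  Normalisable : Tm Γ τ → Set
  Normalisable t = Σ _ λ N → (t ≈ N) × Nf N

  Reducible : ∀ τ → Tm Γ τ → Set
  Reducible (base b) t = Normalisable t
  Reducible o t = Normalisable t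
  Reducible {Γ} (σ ⇒ τ) t =
    ∀ {Δ} (ρ : Ren Γ Δ) (u : Tm Δ σ) → Reducible σ u → Reducible τ (app (rename ρ t) u)

  Reducible-≈ : ∀ τ {t u : Tm Γ τ} → t ≈ u → Reducible τ t → Reducible τ u
  Reducible-≈ (base b) p (N , q , n) = N , ≈trans (≈sym p) q , n
  Reducible-≈ o p (N , q , n)        = N , ≈trans (≈sym p) q , n
  Reducible-≈ (σ ⇒ τ) p r ρ u ru     = Reducible-≈ τ (≈app (≈-rename ρ p) ≈refl) (r ρ u ru)

  Reducible-rename : ∀ τ (ρ : Ren Γ Δ) {t : Tm Γ τ} → Reducible τ t → Reducible τ (rename ρ t)
  Reducible-rename (base b) ρ (N , q , n) = rename ρ N , ≈-rename ρ q , Nf-rename ρ n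
  Reducible-rename o ρ (N , q , n)        = rename ρ N , ≈-rename ρ q , Nf-rename ρ n
  Reducible-rename (σ ⇒ τ) ρ {t} r ρ' u ru =
    Reducible-≈ τ (≈app (≡⇒≈ (sym (rename-rename ρ ρ' t))) ≈refl) (r (λ x → ρ' (ρ x)) u ru)

  mutual
    reflect : ∀ τ {t : Tm Γ τ} → Ne t → Reducible τ t
    reflect (base b) n = _ , ≈refl , nne n
    reflect o n        = _ , ≈refl , nne n
    reflect (σ ⇒ τ) n ρ u ru with reify σ ru
    ... | N , u≈N , m = Reducible-≈ τ (≈app ≈refl (≈sym u≈N)) (reflect τ (napp (Ne-rename ρ n) m))

    reify : ∀ τ {t : Tm Γ τ} → Reducible τ t → Normalisable t
    reify (base b) r = r
    reify o r        = r
    reify (σ ⇒ τ) {t} r with reify τ (r there (var here) (reflect σ (nvar here)))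
    ... | N , q , m = lam N , ≈trans (≈η t) (≈lam q) , nlam m

  ReducibleSub : Sub Γ Δ → Set
  ReducibleSub {Γ} θ = ∀ {τ} (x : Γ ∋ τ) → Reducible τ (θ x)

  fundamental : (t : Tm Γ τ) (θ : Sub Γ Δ) → ReducibleSub θ → Reducible τ (subst θ t)
  fundamental (var x) θ h   = h x
  fundamental (con c) θ h   = reflect _ (ncon c)
  fundamental (nom α i) θ h = reflect _ (nnom α i)
  fundamental {τ = σ ⇒ τ} (lam t) θ h ρ u ru =
    Reducible-≈ τ (≈sym β-step)
      (fundamental t (cons u (λ x → rename ρ (θ x)))
                     λ { here → ru ; (there x) → Reducible-rename _ ρ (h x) })
    where
      β-step : app (rename ρ (subst θ (lam t))) u ≈ subst (cons u (λ x → rename ρ (θ x))) t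
      β-step = ≈trans (≈β _ _)
        (≡⇒≈ (trans (cong (_[ u ]) (rename-exts θ ρ t)) (subst-exts-[] (λ x → rename ρ (θ x)) t u)))
  fundamental (app {σ} {τ} t u) θ h =
    Reducible-≈ τ (≈app (≡⇒≈ (rename-id _)) ≈refl)
      (fundamental t θ h (λ x → x) (subst θ u) (fundamental u θ h))
  fundamental botC θ h       = reflect _ nbot
  fundamental topC θ h       = reflect _ ntop
  fundamental andC θ h       = reflect _ nand
  fundamental orC θ h        = reflect _ nor
  fundamental impC θ h       = reflect _ nimp
  fundamental (allC α) θ h   = reflect _ (nall α)
  fundamental (exC α) θ h    = reflect _ (nex α)
  fundamental (nablaC α) θ h = reflect _ (nnab α)

  normalise : (t : Tm Γ τ) → Normalisable t
  normalise {τ = τ} t =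
    reify τ (Reducible-≈ τ (≡⇒≈ (subst-id t)) (fundamental t var (λ x → reflect _ (nvar x))))

  -- Support modulo αβη

  _≟FO_ : (α β : FO) → Dec (α ≡ β)
  fbase a ≟FO fbase b with a ≟Fin b
  ... | yes refl = yes refl
  ... | no a≢b   = no λ { refl → a≢b refl }
  fbase _ ≟FO (_ ⇒f _) = no λ ()
  (_ ⇒f _) ≟FO fbase _ = no λ ()
  (α ⇒f β) ≟FO (α' ⇒f β') with α ≟FO α' | β ≟FO β'
  ... | yes refl | yes refl = yes refl
  ... | no α≢α'  | _        = no λ { refl → α≢α' refl }
  ... | yes _    | no β≢β'  = no λ { refl → β≢β' refl }

  Nominal : Set
  Nominal = Σ FO λ _ → ℕ

  _≟Nom_ : (a b : Nominal) → Dec (a ≡ b)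
  _≟Nom_ = ≡-dec _≟FO_ _≟ℕ_

  -- The nominal (α₀, i₀)
  -- denotes embed true, every other constant embed false, and embed b ors b
  -- with the observations of its arguments; hence observing a β-normal term
  -- at all-false arguments yields true iff (α₀, i₀) occurs in it.  Without
  -- function extensionality, αβη-soundness holds only up to the partial
  -- equivalence Equal.
  module OccurrenceModel (α₀ : FO) (i₀ : ℕ) where
    Val : Type → Set
    Val (base b) = Bool
    Val o        = Bool
    Val (σ ⇒ τ)  = Val σ → Val τ

    mutual
      embed : ∀ τ → Bool → Val τ
      embed (base b) x = x
      embed o x        = x
      embed (σ ⇒ τ) x  = λ a → embed τ (x ∨ observe σ a)

      observe : ∀ τ → Val τ → Bool
      observe (base b) x = x
      observe o x        = x
      observe (σ ⇒ τ) f  = observe τ (f (embed σ false))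

    observe-embed : ∀ τ b → observe τ (embed τ b) ≡ b
    observe-embed (base x) b = refl
    observe-embed o b        = refl
    observe-embed (σ ⇒ τ) b  =
      trans (observe-embed τ _) (trans (cong (b ∨_) (observe-embed σ false)) (∨-identityʳ b))

    isTarget : FO → ℕ → Bool
    isTarget β j = does ((β , j) ≟Nom (α₀ , i₀))

    Env : Ctx → Set
    Env Γ = ∀ {τ} → Γ ∋ τ → Val τ

    _∷ᵉ_ : Val σ → Env Γ → Env (σ ∷ Γ)
    (a ∷ᵉ ρ) here      = a
    (a ∷ᵉ ρ) (there x) = ρ x

    eval : Tm Γ τ → Env Γ → Val τ
    eval (var x) ρ             = ρ x
    eval {τ = τ} (con c) ρ     = embed τ false
    eval (nom α i) ρ           = embed ⌊ α ⌋ (isTarget α i)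
    eval (lam t) ρ             = λ a → eval t (a ∷ᵉ ρ)
    eval (app t u) ρ           = eval t ρ (eval u ρ)
    eval {τ = τ} botC ρ        = embed τ false
    eval {τ = τ} topC ρ        = embed τ false
    eval {τ = τ} andC ρ        = embed τ false
    eval {τ = τ} orC ρ         = embed τ false
    eval {τ = τ} impC ρ        = embed τ false
    eval {τ = τ} (allC α) ρ    = embed τ false
    eval {τ = τ} (exC α) ρ     = embed τ false
    eval {τ = τ} (nablaC α) ρ  = embed τ false

    Equal : ∀ τ → Val τ → Val τ → Set
    Equal (base b) x y = x ≡ y
    Equal o x y        = x ≡ y
    Equal (σ ⇒ τ) f g  = ∀ a b → Equal σ a b → Equal τ (f a) (g b)

    Equal-sym : ∀ τ {a b} → Equal τ a b → Equal τ b a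
    Equal-sym (base x) p = sym p
    Equal-sym o p        = sym p
    Equal-sym (σ ⇒ τ) p a b q = Equal-sym τ (p b a (Equal-sym σ q))

    Equal-trans : ∀ τ {a b c} → Equal τ a b → Equal τ b c → Equal τ a c
    Equal-trans (base x) p q = trans p q
    Equal-trans o p q        = trans p q
    Equal-trans (σ ⇒ τ) p q a b r =
      Equal-trans τ (p a b r) (q b b (Equal-trans σ (Equal-sym σ r) r))

    Equal-reflˡ : ∀ τ {a b} → Equal τ a b → Equal τ a a
    Equal-reflˡ τ p = Equal-trans τ p (Equal-sym τ p)

    Equal-reflʳ : ∀ τ {a b} → Equal τ a b → Equal τ b b
    Equal-reflʳ τ p = Equal-trans τ (Equal-sym τ p) p

    mutual
      observe-Equal : ∀ τ {a b} → Equal τ a b → observe τ a ≡ observe τ b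
      observe-Equal (base x) p = p
      observe-Equal o p        = p
      observe-Equal (σ ⇒ τ) p  = observe-Equal τ (p _ _ (embed-Equal σ))

      embed-Equal : ∀ τ {x} → Equal τ (embed τ x) (embed τ x)
      embed-Equal (base b) = refl
      embed-Equal o        = refl
      embed-Equal (σ ⇒ τ) {x} a b q =
        transport (λ y → Equal τ (embed τ (x ∨ observe σ a)) (embed τ (x ∨ y)))
                  (observe-Equal σ q) (embed-Equal τ)

    EnvEqual : Env Γ → Env Γ → Set
    EnvEqual {Γ} ρ ρ' = ∀ {τ} (x : Γ ∋ τ) → Equal τ (ρ x) (ρ' x)

    EnvEqual-∷ : {ρ ρ' : Env Γ} {a b : Val σ} → Equal σ a b → EnvEqual ρ ρ' →
                 EnvEqual (a ∷ᵉ ρ) (b ∷ᵉ ρ')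
    EnvEqual-∷ q h here      = q
    EnvEqual-∷ q h (there x) = h x

    eval-cong : (t : Tm Γ τ) {ρ ρ' : Env Γ} → EnvEqual ρ ρ' → Equal τ (eval t ρ) (eval t ρ')
    eval-cong (var x) h             = h x
    eval-cong {τ = τ} (con c) h     = embed-Equal τ
    eval-cong {τ = τ} (nom α i) h   = embed-Equal τ
    eval-cong (lam t) h a b q       = eval-cong t (EnvEqual-∷ q h)
    eval-cong (app t u) h           = eval-cong t h _ _ (eval-cong u h)
    eval-cong {τ = τ} botC h        = embed-Equal τ
    eval-cong {τ = τ} topC h        = embed-Equal τ
    eval-cong {τ = τ} andC h        = embed-Equal τ
    eval-cong {τ = τ} orC h         = embed-Equal τ
    eval-cong {τ = τ} impC h        = embed-Equal τ
    eval-cong {τ = τ} (allC α) h    = embed-Equal τ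
    eval-cong {τ = τ} (exC α) h     = embed-Equal τ
    eval-cong {τ = τ} (nablaC α) h  = embed-Equal τ

    eval-rename : (r : Ren Γ Δ) (t : Tm Γ τ) {ρ : Env Δ} {ρ' : Env Γ} →
                  EnvEqual (λ x → ρ (r x)) ρ' → Equal τ (eval (rename r t) ρ) (eval t ρ')
    eval-rename r (var x) h            = h x
    eval-rename {τ = τ} r (con c) h    = embed-Equal τ
    eval-rename {τ = τ} r (nom α i) h  = embed-Equal τ
    eval-rename r (lam t) h a b q      = eval-rename (ext r) t λ { here → q ; (there x) → h x }
    eval-rename r (app t u) h          = eval-rename r t h _ _ (eval-rename r u h)
    eval-rename {τ = τ} r botC h       = embed-Equal τ
    eval-rename {τ = τ} r topC h       = embed-Equal τ
    eval-rename {τ = τ} r andC h       = embed-Equal τ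
    eval-rename {τ = τ} r orC h        = embed-Equal τ
    eval-rename {τ = τ} r impC h       = embed-Equal τ
    eval-rename {τ = τ} r (allC α) h   = embed-Equal τ
    eval-rename {τ = τ} r (exC α) h    = embed-Equal τ
    eval-rename {τ = τ} r (nablaC α) h = embed-Equal τ

    eval-subst : (θ : Sub Γ Δ) (t : Tm Γ τ) {ρ : Env Δ} {ρ' : Env Γ} → EnvEqual ρ ρ →
                 EnvEqual (λ x → eval (θ x) ρ) ρ' → Equal τ (eval (subst θ t) ρ) (eval t ρ')
    eval-subst θ (var x) hh h            = h x
    eval-subst {τ = τ} θ (con c) hh h    = embed-Equal τ
    eval-subst {τ = τ} θ (nom α i) hh h  = embed-Equal τ
    eval-subst θ (lam {σ} t) {ρ} hh h a b q =
      eval-subst (exts θ) t (EnvEqual-∷ (Equal-reflˡ σ q) hh)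
        λ { here → q ; (there x) → Equal-trans _ (eval-rename there (θ x) {a ∷ᵉ ρ} {ρ} hh) (h x) }
    eval-subst θ (app t u) hh h          = eval-subst θ t hh h _ _ (eval-subst θ u hh h)
    eval-subst {τ = τ} θ botC hh h       = embed-Equal τ
    eval-subst {τ = τ} θ topC hh h       = embed-Equal τ
    eval-subst {τ = τ} θ andC hh h       = embed-Equal τ
    eval-subst {τ = τ} θ orC hh h        = embed-Equal τ
    eval-subst {τ = τ} θ impC hh h       = embed-Equal τ
    eval-subst {τ = τ} θ (allC α) hh h   = embed-Equal τ
    eval-subst {τ = τ} θ (exC α) hh h    = embed-Equal τ
    eval-subst {τ = τ} θ (nablaC α) hh h = embed-Equal τ

    eval-≈ : {t u : Tm Γ τ} → t ≈ u → {ρ ρ' : Env Γ} → EnvEqual ρ ρ' →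
             Equal τ (eval t ρ) (eval u ρ')
    eval-≈ {t = t} ≈refl h = eval-cong t h
    eval-≈ {τ = τ} (≈sym p) h = Equal-sym τ (eval-≈ p (λ x → Equal-sym _ (h x)))
    eval-≈ {τ = τ} (≈trans p q) h = Equal-trans τ (eval-≈ p (λ x → Equal-reflˡ _ (h x))) (eval-≈ q h)
    eval-≈ (≈app p q) h = eval-≈ p h _ _ (eval-≈ q h)
    eval-≈ (≈lam p) h a b q = eval-≈ p (EnvEqual-∷ q h)
    eval-≈ {τ = τ} (≈β t u) {ρ} {ρ'} h =
      transport (λ s → Equal τ (eval t (eval u ρ ∷ᵉ ρ)) (eval s ρ')) (sym ([]≡subst-cons t u))
        (Equal-trans τ (eval-cong t (EnvEqual-∷ (eval-cong u h) h))
          (Equal-sym τ (eval-subst (cons u var) t (λ x → Equal-reflʳ _ (h x))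
              λ { here → eval-cong u (λ x → Equal-reflʳ _ (h x)) ; (there x) → Equal-reflʳ _ (h x) })))
    eval-≈ {τ = σ ⇒ τ} (≈η t) {ρ} {ρ'} h a b q =
      Equal-trans τ (eval-cong t h a b q)
        (Equal-sym τ (eval-rename there t {b ∷ᵉ ρ'} {ρ'} (λ x → Equal-reflʳ _ (h x))
                                  b b (Equal-reflʳ σ q)))

    flag : Tm Γ τ → Bool
    flag {τ = τ} t = observe τ (eval t (λ {τ} _ → embed τ false))

    flag-≈ : {t u : Tm Γ τ} → t ≈ u → flag t ≡ flag u
    flag-≈ {τ = τ} p = observe-Equal τ (eval-≈ p (λ x → embed-Equal _))

    FalseEnv : Env Γ → Set
    FalseEnv {Γ} ρ = ∀ {τ} (x : Γ ∋ τ) → ρ x ≡ embed τ false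

    mutual
      Ne-eval : {t : Tm Γ τ} → Ne t → {ρ : Env Γ} → FalseEnv ρ →
                Σ Bool λ b → (eval t ρ ≡ embed τ b) × (OccN α₀ i₀ t → b ≡ true)
      Ne-eval (nvar x) h   = false , h x , λ ()
      Ne-eval (ncon c) h   = false , refl , λ ()
      Ne-eval (nnom α i) h =
        isTarget α i , refl , λ { onom → dec-true ((α₀ , i₀) ≟Nom (α₀ , i₀)) refl }
      Ne-eval nbot h       = false , refl , λ ()
      Ne-eval ntop h       = false , refl , λ ()
      Ne-eval nand h       = false , refl , λ ()
      Ne-eval nor h        = false , refl , λ ()
      Ne-eval nimp h       = false , refl , λ ()
      Ne-eval (nall α) h   = false , refl , λ ()
      Ne-eval (nex α) h    = false , refl , λ ()
      Ne-eval (nnab α) h   = false , refl , λ ()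
      Ne-eval (napp {σ} {u = u} n m) {ρ} h with Ne-eval n h
      ... | b , e , occ⇒b =
        (b ∨ observe σ (eval u ρ)) , cong (λ g → g (eval u ρ)) e ,
        λ { (oappl oc) → cong (_∨ observe σ (eval u ρ)) (occ⇒b oc)
          ; (oappr oc) → trans (cong (b ∨_) (Nf-observe m h oc)) (∨-zeroʳ b) }

      Nf-observe : {t : Tm Γ τ} → Nf t → {ρ : Env Γ} → FalseEnv ρ →
                   OccN α₀ i₀ t → observe τ (eval t ρ) ≡ true
      Nf-observe (nlam m) h (olam oc) = Nf-observe m (λ { here → refl ; (there x) → h x }) oc
      Nf-observe {τ = τ} (nne n) h oc with Ne-eval n h
      ... | b , e , occ⇒b = trans (cong (observe τ) e) (trans (observe-embed τ b) (occ⇒b oc))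

    OccN⇒flag : {t : Tm Γ τ} → Nf t → OccN α₀ i₀ t → flag t ≡ true
    OccN⇒flag n = Nf-observe n (λ x → refl)

    Unflagged : ∀ τ → Val τ → Set
    Unflagged (base b) x = x ≡ false
    Unflagged o x        = x ≡ false
    Unflagged (σ ⇒ τ) f  = ∀ a → Unflagged σ a → Unflagged τ (f a)

    mutual
      embed-Unflagged : ∀ τ → Unflagged τ (embed τ false)
      embed-Unflagged (base b) = refl
      embed-Unflagged o        = refl
      embed-Unflagged (σ ⇒ τ) a fa =
        transport (λ y → Unflagged τ (embed τ y)) (sym (observe-Unflagged σ fa)) (embed-Unflagged τ)

      observe-Unflagged : ∀ τ {a} → Unflagged τ a → observe τ a ≡ false
      observe-Unflagged (base b) f = f
      observe-Unflagged o f        = f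
      observe-Unflagged (σ ⇒ τ) f  = observe-Unflagged τ (f _ (embed-Unflagged σ))

    isTarget-false : ∀ α i → ¬ OccN α₀ i₀ {Γ} (nom α i) → isTarget α i ≡ false
    isTarget-false α i ¬occ with (α , i) ≟Nom (α₀ , i₀)
    ... | yes refl = ⊥-elim (¬occ onom)
    ... | no _     = refl

    eval-Unflagged : (t : Tm Γ τ) → ¬ OccN α₀ i₀ t → {ρ : Env Γ} →
                     (∀ {σ} (x : Γ ∋ σ) → Unflagged σ (ρ x)) → Unflagged τ (eval t ρ)
    eval-Unflagged (var x) ¬occ h            = h x
    eval-Unflagged {τ = τ} (con c) ¬occ h    = embed-Unflagged τ
    eval-Unflagged (nom α i) ¬occ h          =
      transport (λ y → Unflagged ⌊ α ⌋ (embed ⌊ α ⌋ y)) (sym (isTarget-false α i ¬occ))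
                (embed-Unflagged _)
    eval-Unflagged (lam t) ¬occ h a fa       =
      eval-Unflagged t (λ oc → ¬occ (olam oc)) λ { here → fa ; (there x) → h x }
    eval-Unflagged (app t u) ¬occ h          =
      eval-Unflagged t (λ oc → ¬occ (oappl oc)) h _ (eval-Unflagged u (λ oc → ¬occ (oappr oc)) h)
    eval-Unflagged {τ = τ} botC ¬occ h       = embed-Unflagged τ
    eval-Unflagged {τ = τ} topC ¬occ h       = embed-Unflagged τ
    eval-Unflagged {τ = τ} andC ¬occ h       = embed-Unflagged τ
    eval-Unflagged {τ = τ} orC ¬occ h        = embed-Unflagged τ
    eval-Unflagged {τ = τ} impC ¬occ h       = embed-Unflagged τ
    eval-Unflagged {τ = τ} (allC α) ¬occ h   = embed-Unflagged τ
    eval-Unflagged {τ = τ} (exC α) ¬occ h    = embed-Unflagged τ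
    eval-Unflagged {τ = τ} (nablaC α) ¬occ h = embed-Unflagged τ

    OccN? : (t : Tm Γ τ) → Dec (OccN α₀ i₀ t)
    OccN? (var x) = no λ ()
    OccN? (con c) = no λ ()
    OccN? (nom α i) with (α , i) ≟Nom (α₀ , i₀)
    ... | yes refl = yes onom
    ... | no ≢     = no λ { onom → ≢ refl }
    OccN? (lam t) with OccN? t
    ... | yes oc = yes (olam oc)
    ... | no ¬oc = no λ { (olam oc) → ¬oc oc }
    OccN? (app t u) with OccN? t | OccN? u
    ... | yes oc | _      = yes (oappl oc)
    ... | no _   | yes oc = yes (oappr oc)
    ... | no ¬oc | no ¬oc' = no λ { (oappl oc) → ¬oc oc ; (oappr oc) → ¬oc' oc }
    OccN? botC       = no λ ()
    OccN? topC       = no λ ()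
    OccN? andC       = no λ ()
    OccN? orC        = no λ ()
    OccN? impC       = no λ ()
    OccN? (allC α)   = no λ ()
    OccN? (exC α)    = no λ ()
    OccN? (nablaC α) = no λ ()

    flag⇒OccN : (t : Tm Γ τ) → flag t ≡ true → OccN α₀ i₀ t
    flag⇒OccN {τ = τ} t e with OccN? t
    ... | yes oc = oc
    ... | no ¬oc with trans (sym e) (observe-Unflagged τ (eval-Unflagged t ¬oc (λ x → embed-Unflagged _)))
    ... | ()

  OccN-Nf⇒InSupp : ∀ {α i} {t N : Tm Γ τ} → t ≈ N → Nf N → OccN α i N → InSupp α i t
  OccN-Nf⇒InSupp {α = α} {i} t≈N nf oc t' t'≈t =
    flag⇒OccN t' (trans (flag-≈ (≈trans t'≈t t≈N)) (OccN⇒flag nf oc))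
    where open OccurrenceModel α i

  noms : Tm Γ τ → List Nominal
  noms (nom α i)  = (α , i) ∷ []
  noms (lam t)    = noms t
  noms (app t u)  = noms t ++ noms u
  noms (var x)    = []
  noms (con c)    = []
  noms botC       = []
  noms topC       = []
  noms andC       = []
  noms orC        = []
  noms impC       = []
  noms (allC α)   = []
  noms (exC α)    = []
  noms (nablaC α) = []

  OccN⇒∈noms : ∀ {α i} {t : Tm Γ τ} → OccN α i t → (α , i) ∈ noms t
  OccN⇒∈noms onom                 = Any.here refl
  OccN⇒∈noms (oappl oc)           = ∈-++⁺ˡ (OccN⇒∈noms oc)
  OccN⇒∈noms (oappr {t = t} oc)   = ∈-++⁺ʳ (noms t) (OccN⇒∈noms oc)
  OccN⇒∈noms (olam oc)            = OccN⇒∈noms oc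

  ∈noms⇒OccN : ∀ {α i} (t : Tm Γ τ) → (α , i) ∈ noms t → OccN α i t
  ∈noms⇒OccN (nom α i) (Any.here refl) = onom
  ∈noms⇒OccN (lam t) m                 = olam (∈noms⇒OccN t m)
  ∈noms⇒OccN (app t u) m with ∈-++⁻ (noms t) m
  ... | inj₁ m' = oappl (∈noms⇒OccN t m')
  ... | inj₂ m' = oappr (∈noms⇒OccN u m')

  supportList : (C : Tm Γ τ) → Σ (List Nominal) λ ns → Lists ns C
  supportList C with normalise C
  ... | N , C≈N , nf =
    deduplicate _≟Nom_ (noms N) , deduplicate-! _≟Nom_ (noms N) ,
    λ α i → (λ m → OccN-Nf⇒InSupp C≈N nf (∈noms⇒OccN N (∈-deduplicate⁻ _≟Nom_ (noms N) m))) ,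
            (λ s → ∈-deduplicate⁺ _≟Nom_ (OccN⇒∈noms (s N (≈sym C≈N))))

  maxNom : Tm Γ τ → ℕ
  maxNom (nom α i)  = i
  maxNom (lam t)    = maxNom t
  maxNom (app t u)  = maxNom t ⊔ maxNom u
  maxNom (var x)    = 0
  maxNom (con c)    = 0
  maxNom botC       = 0
  maxNom topC       = 0
  maxNom andC       = 0
  maxNom orC        = 0
  maxNom impC       = 0
  maxNom (allC α)   = 0
  maxNom (exC α)    = 0
  maxNom (nablaC α) = 0

  OccN⇒≤maxNom : ∀ {α i} {t : Tm Γ τ} → OccN α i t → i ≤ maxNom t
  OccN⇒≤maxNom onom                   = ≤-refl
  OccN⇒≤maxNom (oappl {t = t} {u} oc) = ≤-trans (OccN⇒≤maxNom oc) (m≤m⊔n (maxNom t) (maxNom u))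
  OccN⇒≤maxNom (oappr {t = t} {u} oc) = ≤-trans (OccN⇒≤maxNom oc) (m≤n⊔m (maxNom t) (maxNom u))
  OccN⇒≤maxNom (olam oc)              = OccN⇒≤maxNom oc

  suc-maxNom-fresh : ∀ α (t : Tm Γ τ) → ¬ OccN α (suc (maxNom t)) t
  suc-maxNom-fresh α t oc = <-irrefl refl (OccN⇒≤maxNom oc)

  OccN-⟪⟫⁻ : ∀ {α k} (π : Perm) (t : Tm Γ τ) → OccN α k (t ⟪ π ⟫) → OccN α (inv π α k) t
  OccN-⟪⟫⁻ π (nom β j) onom  = transport (λ z → OccN β z (nom β j)) (sym (invˡ π β j)) onom
  OccN-⟪⟫⁻ π (lam t) (olam oc)   = olam (OccN-⟪⟫⁻ π t oc)
  OccN-⟪⟫⁻ π (app t u) (oappl oc) = oappl (OccN-⟪⟫⁻ π t oc)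
  OccN-⟪⟫⁻ π (app t u) (oappr oc) = oappr (OccN-⟪⟫⁻ π u oc)

  fresh-⟪⟫ : ∀ {α i} (π : Perm) (t : Tm Γ τ) → ¬ OccN α i t → ¬ OccN α (fun π α i) (t ⟪ π ⟫)
  fresh-⟪⟫ {α = α} {i} π t ¬oc oc =
    ¬oc (transport (λ z → OccN α z t) (invˡ π α i) (OccN-⟪⟫⁻ π t oc))

  ¬OccN⇒¬InSupp : ∀ {α i} {t : Tm Γ τ} → ¬ OccN α i t → ¬ InSupp α i t
  ¬OccN⇒¬InSupp ¬oc s = ¬oc (s _ ≈refl)

  applyNomsWith : {τ : FO} → (FO → ℕ → ℕ) → (ns : List Nominal) →
                  Tm Γ ⌊ raiseTy ns τ ⌋ → Tm Γ ⌊ τ ⌋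
  applyNomsWith g []             s = s
  applyNomsWith g ((α , i) ∷ ns) s = applyNomsWith g ns (app s (nom α (g α i)))

  mapNom-applyNomsWith : {τ : FO} (f g : FO → ℕ → ℕ) (ns : List Nominal) (s : Tm Γ ⌊ raiseTy ns τ ⌋) →
                         mapNom f (applyNomsWith g ns s) ≡
                         applyNomsWith (λ α i → f α (g α i)) ns (mapNom f s)
  mapNom-applyNomsWith f g []            s = refl
  mapNom-applyNomsWith f g ((α , i) ∷ ns) s = mapNom-applyNomsWith f g ns _

  applyNomsWith-cong : {τ : FO} {g h : FO → ℕ → ℕ} → (∀ α i → g α i ≡ h α i) → (ns : List Nominal)
                       (s : Tm Γ ⌊ raiseTy ns τ ⌋) → applyNomsWith g ns s ≡ applyNomsWith h ns s
  applyNomsWith-cong e []             s = refl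
  applyNomsWith-cong e ((α , i) ∷ ns) s rewrite e α i = applyNomsWith-cong e ns _

  applyNomsWith-id : {τ : FO} (ns : List Nominal) (s : Tm Γ ⌊ raiseTy ns τ ⌋) →
                     applyNomsWith (λ α i → i) ns s ≡ applyNoms ns s
  applyNomsWith-id []             s = refl
  applyNomsWith-id ((α , i) ∷ ns) s = applyNomsWith-id ns _

  -- Formulas of bounded logical depth

  data BinaryConnective {Γ : Ctx} : Tm Γ (o ⇒ o ⇒ o) → Set where
    is-and : BinaryConnective andC
    is-or  : BinaryConnective orC
    is-imp : BinaryConnective impC

  data Quantifier {Γ : Ctx} (α : FO) : Tm Γ ((⌊ α ⌋ ⇒ o) ⇒ o) → Set where
    is-all   : Quantifier α (allC α)
    is-ex    : Quantifier α (exC α)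
    is-nabla : Quantifier α (nablaC α)

  -- The expansion recurses on n rather than on the derivation
  -- of Shape, because it needs the shapes of permuted subformulas and of
  -- quantifier instances, which are not structural subterms.
  data Shape : {X : VCtx} → ℕ → Tm ⟦ X ⟧ o → Set where
    atomic     : ∀ {X n} {A : Tm ⟦ X ⟧ o} → Atomic A → Shape n A
    bot        : ∀ {X n} → Shape {X} n botC
    top        : ∀ {X n} → Shape {X} n topC
    binary     : ∀ {X n} {b : Tm ⟦ X ⟧ (o ⇒ o ⇒ o)} {A B : Tm ⟦ X ⟧ o} →
                 BinaryConnective b → Shape n A → Shape n B → Shape (suc n) (app (app b A) B)
    quantifier : ∀ {X n α} {q : Tm ⟦ X ⟧ ((⌊ α ⌋ ⇒ o) ⇒ o)} {C : Tm ⟦ X ⟧ (⌊ α ⌋ ⇒ o)} →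
                 Quantifier α q → Shape {α ∷ X} n (unbind C) → Shape (suc n) (app q C)
    step       : ∀ {X n} {A : Tm ⟦ X ⟧ o} → Shape n A → Shape (suc n) A
    convert    : ∀ {X n} {A A' : Tm ⟦ X ⟧ o} → Shape n A → A ≈ A' → Shape n A'

  Shape-≤′ : ∀ {m n} {A : Tm ⟦ X ⟧ o} → m ≤′ n → Shape m A → Shape n A
  Shape-≤′ ≤′-refl s     = s
  Shape-≤′ (≤′-step p) s = step (Shape-≤′ p s)

  BinaryConnective-subst : (θ : Sub Γ Δ) {b : Tm Γ (o ⇒ o ⇒ o)} →
                           BinaryConnective b → BinaryConnective (subst θ b)
  BinaryConnective-subst θ is-and = is-and
  BinaryConnective-subst θ is-or  = is-or
  BinaryConnective-subst θ is-imp = is-imp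

  Quantifier-subst : ∀ {α} (θ : Sub Γ Δ) {q : Tm Γ ((⌊ α ⌋ ⇒ o) ⇒ o)} →
                     Quantifier α q → Quantifier α (subst θ q)
  Quantifier-subst θ is-all   = is-all
  Quantifier-subst θ is-ex    = is-ex
  Quantifier-subst θ is-nabla = is-nabla

  BinaryConnective-mapNom : (f : FO → ℕ → ℕ) {b : Tm Γ (o ⇒ o ⇒ o)} →
                            BinaryConnective b → BinaryConnective (mapNom f b)
  BinaryConnective-mapNom f is-and = is-and
  BinaryConnective-mapNom f is-or  = is-or
  BinaryConnective-mapNom f is-imp = is-imp

  Quantifier-mapNom : ∀ {α} (f : FO → ℕ → ℕ) {q : Tm Γ ((⌊ α ⌋ ⇒ o) ⇒ o)} →
                      Quantifier α q → Quantifier α (mapNom f q)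
  Quantifier-mapNom f is-all   = is-all
  Quantifier-mapNom f is-ex    = is-ex
  Quantifier-mapNom f is-nabla = is-nabla

  Shape-subst : ∀ {X Y n} {A : Tm ⟦ X ⟧ o} → Shape n A → (θ : Sub ⟦ X ⟧ ⟦ Y ⟧) →
                Shape n (subst θ A)
  Shape-subst (atomic a) θ     = atomic (Atomic-subst θ a)
  Shape-subst bot θ            = bot
  Shape-subst top θ            = top
  Shape-subst (binary b s s') θ =
    binary (BinaryConnective-subst θ b) (Shape-subst s θ) (Shape-subst s' θ)
  Shape-subst (quantifier {C = C} q s) θ =
    quantifier (Quantifier-subst θ q)
      (convert (Shape-subst s (exts θ)) (≡⇒≈ (cong (λ c → app c (var here)) (subst-wk θ C))))
  Shape-subst (step s) θ       = step (Shape-subst s θ)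
  Shape-subst (convert s p) θ  = convert (Shape-subst s θ) (≈-subst θ p)

  Shape-mapNom : ∀ {n} {A : Tm ⟦ X ⟧ o} (f : FO → ℕ → ℕ) → Shape n A → Shape n (mapNom f A)
  Shape-mapNom f (atomic a)      = atomic (Atomic-mapNom f a)
  Shape-mapNom f bot             = bot
  Shape-mapNom f top             = top
  Shape-mapNom f (binary b s s') =
    binary (BinaryConnective-mapNom f b) (Shape-mapNom f s) (Shape-mapNom f s')
  Shape-mapNom f (quantifier {C = C} q s) =
    quantifier (Quantifier-mapNom f q)
      (convert (Shape-mapNom f s) (≡⇒≈ (cong (λ c → app c (var here)) (mapNom-rename f there C))))
  Shape-mapNom f (step s)        = step (Shape-mapNom f s)
  Shape-mapNom f (convert s p)   = convert (Shape-mapNom f s) (≈-mapNom f p)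

  Shape-instantiate : ∀ {X Y n α} {C : Tm ⟦ X ⟧ (⌊ α ⌋ ⇒ o)} → Shape {α ∷ X} n (unbind C) →
                      (ρ : Ren ⟦ X ⟧ ⟦ Y ⟧) (t : Tm ⟦ Y ⟧ ⌊ α ⌋) → Shape {Y} n (app (rename ρ C) t)
  Shape-instantiate {C = C} s ρ t =
    convert (Shape-subst s (cons t (λ x → var (ρ x))))
      (≡⇒≈ (cong (λ c → app c t)
                 (trans (subst-rename there (cons t (λ x → var (ρ x))) C) (subst-var ρ C))))

  ∋-firstOrder : ⟦ X ⟧ ∋ τ → Σ FO λ β → ⌊ β ⌋ ≡ τ
  ∋-firstOrder {β ∷ X} here      = β , refl
  ∋-firstOrder {β ∷ X} (there x) = ∋-firstOrder x

  ⇒-injectiveˡ : ∀ {σ τ σ' τ' : Type} → σ ⇒ τ ≡ σ' ⇒ τ' → σ ≡ σ'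
  ⇒-injectiveˡ refl = refl

  ⇒-injectiveʳ : ∀ {σ τ σ' τ' : Type} → σ ⇒ τ ≡ σ' ⇒ τ' → τ ≡ τ'
  ⇒-injectiveʳ refl = refl

  o≢⇒ : ¬ (o ≡ σ ⇒ τ)
  o≢⇒ ()

  firstOrder≢o : ∀ (β : FO) → ¬ (⌊ β ⌋ ≡ o)
  firstOrder≢o (fbase x) ()
  firstOrder≢o (β ⇒f β') ()

  firstOrder≢⇒o : ∀ (β : FO) → ¬ (⌊ β ⌋ ≡ σ ⇒ o)
  firstOrder≢⇒o (fbase x) ()
  firstOrder≢⇒o (β ⇒f β') e = firstOrder≢o β' (⇒-injectiveʳ e)

  data NeView {Γ : Ctx} : ∀ {τ} → Tm Γ τ → Set where
    vatomic : {t : Tm Γ τ} → Atomic t → NeView t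
    vfo     : {t : Tm Γ τ} (β : FO) → ⌊ β ⌋ ≡ τ → NeView t
    vbot    : NeView botC
    vtop    : NeView topC
    vbin₀   : {b : Tm Γ (o ⇒ o ⇒ o)} → BinaryConnective b → NeView b
    vbin₁   : ∀ {b A} → BinaryConnective b → Nf A → NeView (app b A)
    vbin₂   : ∀ {b A B} → BinaryConnective b → Nf A → Nf B → NeView (app (app b A) B)
    vq₀     : ∀ {α q} → Quantifier α q → NeView q
    vq₁     : ∀ {α q C} → Quantifier α q → Nf C → NeView (app q C)

  neView : {t : Tm ⟦ X ⟧ τ} → Ne t → NeView t
  neView (nvar x)   = vfo (proj₁ (∋-firstOrder x)) (proj₂ (∋-firstOrder x))
  neView (ncon c)   = vatomic (acon c)
  neView (nnom α i) = vfo α refl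
  neView nbot       = vbot
  neView ntop       = vtop
  neView nand       = vbin₀ is-and
  neView nor        = vbin₀ is-or
  neView nimp       = vbin₀ is-imp
  neView (nall α)   = vq₀ is-all
  neView (nex α)    = vq₀ is-ex
  neView (nnab α)   = vq₀ is-nabla
  neView (napp n m) with neView n
  ... | vatomic a        = vatomic (aapp a)
  ... | vfo (fbase b) ()
  ... | vfo (β ⇒f β') e  = vfo β' (⇒-injectiveʳ e)
  ... | vbin₀ b          = vbin₁ b m
  ... | vbin₁ b a        = vbin₂ b a m
  ... | vq₀ q            = vq₁ q m

  Ne-predicate⇒Atomic : ∀ {α} {C : Tm ⟦ X ⟧ σ} → Ne C → σ ≡ ⌊ α ⌋ ⇒ o → Atomic C
  Ne-predicate⇒Atomic n e with neView n
  ... | vatomic a   = a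
  ... | vfo β e'    = ⊥-elim (firstOrder≢⇒o β (trans e' e))
  ... | vbot        = ⊥-elim (o≢⇒ e)
  ... | vtop        = ⊥-elim (o≢⇒ e)
  ... | vbin₀ b     = ⊥-elim (o≢⇒ (sym (⇒-injectiveʳ e)))
  ... | vbin₁ b a   = ⊥-elim (firstOrder≢o _ (sym (⇒-injectiveˡ e)))
  ... | vbin₂ b a c = ⊥-elim (o≢⇒ e)
  ... | vq₀ q       = ⊥-elim (firstOrder≢⇒o _ (sym (⇒-injectiveˡ e)))
  ... | vq₁ q c     = ⊥-elim (o≢⇒ e)

  mutual
    Nf⇒Shape : {A : Tm ⟦ X ⟧ o} → Nf A → Σ ℕ λ n → Shape n A
    Nf⇒Shape (nne n) with neView n
    ... | vatomic a = 0 , atomic a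
    ... | vfo β e   = ⊥-elim (firstOrder≢o β e)
    ... | vbot      = 0 , bot
    ... | vtop      = 0 , top
    ... | vbin₂ b a c with Nf⇒Shape a | Nf⇒Shape c
    ... | k , s | l , s' =
      suc (k ⊔ l) , binary b (Shape-≤′ (≤⇒≤′ (m≤m⊔n k l)) s) (Shape-≤′ (≤⇒≤′ (m≤n⊔m k l)) s')
    Nf⇒Shape (nne n) | vq₁ q c with Nf⇒Shape-unbind c
    ... | k , s = suc k , quantifier q s

    Nf⇒Shape-unbind : ∀ {α} {C : Tm ⟦ X ⟧ (⌊ α ⌋ ⇒ o)} → Nf C →
                      Σ ℕ λ n → Shape {α ∷ X} n (unbind C)
    Nf⇒Shape-unbind (nlam {t = B} b) with Nf⇒Shape b
    ... | k , s = k , convert s (≈sym (unbind-lam B))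
    Nf⇒Shape-unbind (nne n) = 0 , atomic (aapp (Atomic-rename there (Ne-predicate⇒Atomic n refl)))

  -- Identity expansion

  module IdentityExpansion (D : DefSet) (I : IndSet) where
    CutFree : (X : VCtx) → List (Tm ⟦ X ⟧ o) → Tm ⟦ X ⟧ o → Set
    CutFree = Deriv D I cutFree

    conv-succedent : ∀ {Γ} {C C' : Tm ⟦ X ⟧ o} → CutFree X Γ C → C ≈ C' → CutFree X Γ C'
    conv-succedent {Γ = Γ} d p = conv d (Γ , ↭-refl , Pointwise.refl ≈refl) p

    exchange : {A B C : Tm ⟦ X ⟧ o} → CutFree X (A ∷ B ∷ []) C → CutFree X (B ∷ A ∷ []) C
    exchange {A = A} {B} d = conv d (B ∷ A ∷ [] , swap A B ↭-refl , ≈refl ∷ ≈refl ∷ []) ≈refl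

    Expands : ℕ → Set
    Expands n = ∀ {X} {A : Tm ⟦ X ⟧ o} → Shape n A → (π : Perm) → CutFree X (A ∷ []) (A ⟪ π ⟫)

    ⊃-expand : ∀ {n} {A B : Tm ⟦ X ⟧ o} → Expands n → Shape n A → Shape n B → (π : Perm) →
               CutFree X (app (app impC A) B ∷ []) (app (app impC A) B ⟪ π ⟫)
    ⊃-expand {A = A} expand s s' π =
      impR (exchange (impL A[π]⊢A (exchange (wL (expand s' π)))))
      where
        A[π]⊢A : CutFree _ (A ⟪ π ⟫ ∷ []) A
        A[π]⊢A = conv-succedent (expand (Shape-mapNom (fun π) s) (π ⁻¹)) (≡⇒≈ (⟪⟫-inverseˡ π A))

    -- The eigenvariable of ∀R is raised over supp(C[π]); instantiating ∀L
    -- with it applied to the π⁻¹-images of those nominals makes the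
    -- permuted instance exactly the ∀R premise.
    ∀-expand : ∀ {n α} {C : Tm ⟦ X ⟧ (⌊ α ⌋ ⇒ o)} → Expands n → Shape {α ∷ X} n (unbind C) →
               (π : Perm) → CutFree X (app (allC α) C ∷ []) (app (allC α) C ⟪ π ⟫)
    ∀-expand {X = X} {α = α} {C = C} expand s π with supportList (C ⟪ π ⟫)
    ... | ns , ns-lists =
      allR ns ns-lists (allL t (conv-succedent (expand (Shape-instantiate s there t) π) (≡⇒≈ instance-⟪⟫)))
      where
        t : Tm ⟦ raiseTy ns α ∷ X ⟧ ⌊ α ⌋
        t = applyNomsWith (inv π) ns (var here)

        instance-⟪⟫ : app (wk C) t ⟪ π ⟫ ≡ app (wk (C ⟪ π ⟫)) (applyNoms ns (var here))
        instance-⟪⟫ = cong₂ app (mapNom-rename (fun π) there C) (begin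
          mapNom (fun π) t
            ≡⟨ mapNom-applyNomsWith (fun π) (inv π) ns (var here) ⟩
          applyNomsWith (λ α i → fun π α (inv π α i)) ns (var here)
            ≡⟨ applyNomsWith-cong (invʳ π) ns (var here) ⟩
          applyNomsWith (λ α i → i) ns (var here)
            ≡⟨ applyNomsWith-id ns (var here) ⟩
          applyNoms ns (var here)                                      ∎)

    ∃-expand : ∀ {n α} {C : Tm ⟦ X ⟧ (⌊ α ⌋ ⇒ o)} → Expands n → Shape {α ∷ X} n (unbind C) →
               (π : Perm) → CutFree X (app (exC α) C ∷ []) (app (exC α) C ⟪ π ⟫)
    ∃-expand {X = X} {α = α} {C = C} expand s π with supportList C
    ... | ns , ns-lists =
      exL ns ns-lists (exR (applyNomsWith (fun π) ns (var here))
        (conv-succedent (expand (Shape-instantiate s there y) π) (≡⇒≈ instance-⟪⟫)))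
      where
        y : Tm ⟦ raiseTy ns α ∷ X ⟧ ⌊ α ⌋
        y = applyNoms ns (var here)

        instance-⟪⟫ : app (wk C) y ⟪ π ⟫ ≡ app (wk (C ⟪ π ⟫)) (applyNomsWith (fun π) ns (var here))
        instance-⟪⟫ = cong₂ app (mapNom-rename (fun π) there C) (begin
          mapNom (fun π) y
            ≡⟨ cong (mapNom (fun π)) (sym (applyNomsWith-id ns (var here))) ⟩
          mapNom (fun π) (applyNomsWith (λ α i → i) ns (var here))
            ≡⟨ mapNom-applyNomsWith (fun π) (λ α i → i) ns (var here) ⟩
          applyNomsWith (fun π) ns (var here)                          ∎)

    ∇-expand : ∀ {n α} {C : Tm ⟦ X ⟧ (⌊ α ⌋ ⇒ o)} → Expands n → Shape {α ∷ X} n (unbind C) →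
               (π : Perm) → CutFree X (app (nablaC α) C ∷ []) (app (nablaC α) C ⟪ π ⟫)
    ∇-expand {n = n} {α = α} {C} expand s π =
      nablaL i (¬OccN⇒¬InSupp i-fresh)
        (nablaR (fun π α i) (¬OccN⇒¬InSupp (fresh-⟪⟫ π C i-fresh))
          (expand instance-shape π))
      where
        i : ℕ
        i = suc (maxNom C)

        i-fresh : ¬ OccN α i C
        i-fresh = suc-maxNom-fresh α C

        instance-shape : Shape n (app C (nom α i))
        instance-shape = convert (Shape-instantiate s (λ x → x) (nom α i))
                                 (≡⇒≈ (cong (λ c → app c (nom α i)) (rename-id C)))

    expand : ∀ n → Expands n
    expand n       (atomic a) π              = init a π
    expand n       bot π                     = botL
    expand n       top π                     = topR
    expand (suc n) (binary is-and s s') π    = andR (andL₁ (expand n s π)) (andL₂ (expand n s' π))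
    expand (suc n) (binary is-or s s') π     = orL (orR₁ (expand n s π)) (orR₂ (expand n s' π))
    expand (suc n) (binary is-imp s s') π    = ⊃-expand (expand n) s s' π
    expand (suc n) (quantifier is-all s) π   = ∀-expand (expand n) s π
    expand (suc n) (quantifier is-ex s) π    = ∃-expand (expand n) s π
    expand (suc n) (quantifier is-nabla s) π = ∇-expand (expand n) s π
    expand (suc n) (step s) π                = expand n s π
    expand n       (convert s p) π           =
      conv (expand n s π) (_ ∷ [] , ↭-refl , p ∷ []) (≈-mapNom (fun π) p)

    identity : (X : VCtx) (B : Tm ⟦ X ⟧ o) (π : Perm) → CutFree X (B ∷ []) (B ⟪ π ⟫)
    identity X B π with normalise B
    ... | N , B≈N , nf with Nf⇒Shape nf
    ... | n , s = expand n (convert s (≈sym B≈N)) π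

mainTheorem6 : (Sg : Signature) → let open LD Sg in
    (D : DefSet) (I : IndSet) → ValidD D → ValidI I D → Stratified D I →
    (X : VCtx) (B : Tm ⟦ X ⟧ o) (π : Perm) → PermOf π B →
    Deriv D I cutFree X (B ∷ []) (B ⟪ π ⟫)
mainTheorem6 Sg D I _ _ _ X B π _ = Metatheory.IdentityExpansion.identity Sg D I X B π
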